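{- For $n\ge1$, $$(1+x)R_{n+1}(x)=2x\sum_{k=0}^n\binom{n}{k}M_k(x)P_{n-k}(x^2),$$ and $$M_{n+1}(x)=x\sum_{k=0}^n\binom{n}{k}M_k(x)P_{n-k}(x^2).$$
   Context: $\mathfrak{S}_n$ is the symmetric group on $[n]$. A word $w_0\cdots w_m$ of distinct integers changes direction at position $i$ ($0<i<m$) if $w_{i-1}<w_i>w_{i+1}$ or $w_{i-1}>w_i<w_{i+1}$, and has $k$ alternating runs if it changes direction at exactly $k-1$ positions. $R(n,k)$ is the number of $\pi\in\mathfrak{S}_n$ whose word $\pi(1)\cdots\pi(n)$ has $k$ alternating runs, and $R_n(x)=\sum_{k=1}^{n-1}R(n,k)x^k$. $M(n,k)$ is the number of $\pi\in\mathfrak{S}_n$ whose word $0\pi(1)\cdots\pi(n)$ has $k$ alternating runs, with $M(0,0)=1$, and $M_n(x)=\sum_{k=0}^nM(n,k)x^k$ (so $M_0(x)=1$). A left peak index of $\pi\in\mathfrak{S}_n$ is $i\in[n-1]$ with $\pi(i-1)<\pi(i)>\pi(i+1)$ where $\pi(0)=0$; $P(n,k)$ is the number of $\pi\in\mathfrak{S}_n$ with $k$ left peak indices (so $P(0,0)=1$), and $P_n(x)=\sum_{k=0}^{\lfloor n/2\rfloor}P(n,k)x^k$. -}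

module Defs where

open import Data.Nat using (ℕ; zero; suc; _+_; _*_; _∸_; _≤_; _<ᵇ_; _≟_; _≤?_; _/_; _%_)
open import Data.Nat.Combinatorics using (_C_)
open import Data.Bool using (Bool; true; false; _∧_; _∨_; if_then_else_)
open import Data.List using (List; []; _∷_; map; concatMap; filter; length; upTo)
open import Data.Nat.ListAction using (sum)
open import Data.List.Relation.Unary.Unique.DecPropositional _≟_ using (unique?)
open import Relation.Nullary using (yes; no)
open import Relation.Nullary.Decidable using (_×-dec_)
open import Relation.Binary.PropositionalEquality using (_≡_)

words : ℕ → ℕ → List (List ℕ)
words zero    n = [] ∷ []
words (suc l) n = concatMap (λ a → map (a ∷_) (words l n)) (map suc (upTo n))

-- 𝔖_n, as the words π(1)⋯π(n) of length n over [n] with distinct letters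
perms : ℕ → List (List ℕ)
perms n = filter (unique?) (words n n)

changesDir : ℕ → ℕ → ℕ → Bool
changesDir a b c = ((a <ᵇ b) ∧ (c <ᵇ b)) ∨ ((b <ᵇ a) ∧ (b <ᵇ c))

dirChanges : List ℕ → ℕ
dirChanges (a ∷ b ∷ c ∷ w) =
  (if changesDir a b c then 1 else 0) + dirChanges (b ∷ c ∷ w)
dirChanges _ = 0

-- number of alternating runs: k runs iff exactly k-1 changes of direction
altRuns : List ℕ → ℕ
altRuns w = suc (dirChanges w)

interiorPeaks : List ℕ → ℕ
interiorPeaks (a ∷ b ∷ c ∷ w) =
  (if (a <ᵇ b) ∧ (c <ᵇ b) then 1 else 0) + interiorPeaks (b ∷ c ∷ w)
interiorPeaks _ = 0

-- left peak indices of π: i ∈ [n-1] with π(i-1) < π(i) > π(i+1), π(0)=0,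
-- i.e. the interior peaks of the word 0 π(1) ⋯ π(n)
leftPeaks : List ℕ → ℕ
leftPeaks π = interiorPeaks (0 ∷ π)

R : ℕ → ℕ → ℕ
R n k = length (filter (λ π → altRuns π ≟ k) (perms n))

M : ℕ → ℕ → ℕ
M n k = length (filter (λ π → altRuns (0 ∷ π) ≟ k) (perms n))

P : ℕ → ℕ → ℕ
P n k = length (filter (λ π → leftPeaks π ≟ k) (perms n))

-- Polynomials with ℕ coefficients, represented by coefficient functions

Poly : Set
Poly = ℕ → ℕ

_≈P_ : Poly → Poly → Set
p ≈P q = ∀ d → p d ≡ q d

infix 4 _≈P_
infixl 6 _⊕_
infixl 7 _⊛_

_⊕_ : Poly → Poly → Poly
(p ⊕ q) d = p d + q d

_⊛_ : Poly → Poly → Poly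
(p ⊛ q) d = sum (map (λ i → p i * q (d ∸ i)) (upTo (suc d)))

_·P_ : ℕ → Poly → Poly
(c ·P p) d = c * p d

onePlusX : Poly
onePlusX zero          = 1
onePlusX (suc zero)    = 1
onePlusX (suc (suc _)) = 0

X* : Poly → Poly
X* p zero    = 0
X* p (suc d) = p d

atSquare : Poly → Poly
atSquare p d with d % 2 ≟ 0
... | yes _ = p (d / 2)
... | no  _ = 0

ΣP : ℕ → (ℕ → Poly) → Poly
ΣP n f d = sum (map (λ k → f k d) (upTo (suc n)))

Rpoly : ℕ → Poly
Rpoly n k with (1 ≤? k) ×-dec (suc k ≤? n)
... | yes _ = R n k
... | no  _ = 0

-- M_n(x) = Σ_{k=0}^{n} M(n,k) x^k, with M(0,0) = 1 (so M_0(x) = 1)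
Mpoly : ℕ → Poly
Mpoly zero zero    = 1
Mpoly zero (suc _) = 0
Mpoly (suc n) k with k ≤? suc n
... | yes _ = M (suc n) k
... | no  _ = 0

Ppoly : ℕ → Poly
Ppoly n k with k ≤? n / 2
... | yes _ = P n k
... | no  _ = 0

convSum : ℕ → Poly
convSum n = ΣP n (λ k → (n C k) ·P (Mpoly k ⊛ atSquare (Ppoly (n ∸ k))))

module Submission where

-- We list
-- 𝔖_{n+1} by inserting the letter n+1 into each π ∈ 𝔖_n (a reordering of the
-- list in Defs).  Writing the result as σ (n+1) τ, the word 0 σ (n+1) τ has
-- 1 + 2 lpk(σ) + runs((n+1) τ) alternating runs, and both summands only depend
-- on the standardizations of σ and τ.  The binomial splitting lemma (induction
-- on n with Pascal's rule) shows that standardized splittings of 𝔖_n produce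
-- each pair in 𝔖_j × 𝔖_{n-j} exactly C(n,j) times, and complementation
-- β ↦ (m+1) - β turns runs((n+1) β) into runs(0 β^c); this is the M identity.
-- For the R identity, 0 π and 0 π^c have runs(π) and runs(π) + 1 runs.

open import Defs
open import Data.Nat
open import Data.Nat.Properties
open import Data.Nat.DivMod using (m≡m%n+[m/n]*n; m*n%n≡0; m*n/n≡m; /-monoˡ-≤)
open import Data.Nat.Combinatorics using (_C_; nCk+nC[k+1]≡[n+1]C[k+1]; k>n⇒nCk≡0; nCk≡nC[n∸k])
open import Data.Nat.ListAction using (sum)
open import Data.Nat.ListAction.Properties using (sum-++; sum-↭)
open import Data.Nat.Tactic.RingSolver using (solve-∀)
open import Data.Bool using (Bool; true; false; _∧_; if_then_else_; T)
open import Data.Bool.Properties using (∨-comm; ∨-identityʳ; ∧-conicalʳ)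
open import Data.Unit using (⊤; tt)
open import Data.Empty using (⊥-elim)
open import Data.List using (List; []; _∷_; map; concatMap; filter; length; upTo; _++_; _∷ʳ_)
open import Data.List.Properties using (map-++; map-∘; map-cong-local; map-id; upTo-∷ʳ; length-++; length-map; ∷-injective; ∷-injectiveʳ)
open import Data.List.Membership.Propositional using (_∈_; _∉_; find; lose)
open import Data.List.Membership.Propositional.Properties
open import Data.List.Membership.Propositional.Properties.WithK using (unique∧set⇒bag)
open import Data.List.Membership.DecPropositional _≟_ using (_∈?_)
open import Data.List.Relation.Unary.Any using (here; there)
open import Data.List.Relation.Unary.All using (All; []; _∷_)
import Data.List.Relation.Unary.All as All
import Data.List.Relation.Unary.All.Properties as All
open import Data.List.Relation.Unary.AllPairs using (AllPairs; []; _∷_)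
import Data.List.Relation.Unary.AllPairs as AllPairs
import Data.List.Relation.Unary.AllPairs.Properties as AllPairs
open import Data.List.Relation.Unary.Unique.Propositional using (Unique)
import Data.List.Relation.Unary.Unique.Propositional.Properties as Unique
open import Data.List.Relation.Unary.Unique.DecPropositional _≟_ using (unique?)
open import Data.List.Relation.Binary.Disjoint.Propositional using (Disjoint)
open import Data.List.Relation.Binary.BagAndSetEquality using (∼bag⇒↭)
open import Data.Product using (_×_; _,_; ∃; ∃₂; proj₁; proj₂)
open import Function.Bundles using (mk⇔)
open import Data.List.Relation.Binary.Permutation.Propositional using (_↭_)
import Data.List.Relation.Binary.Permutation.Propositional.Properties as ↭
open import Relation.Nullary using (yes; no; ¬_)
open import Relation.Nullary.Decidable using (_×-dec_)
open import Relation.Binary using (tri<; tri≈; tri>)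
open import Relation.Binary.PropositionalEquality
open import Function using (_∘_; id)

sumOf : {A : Set} → List A → (A → ℕ) → ℕ
sumOf L f = sum (map f L)

sumOf-++ : {A : Set} (xs ys : List A) (f : A → ℕ) →
  sumOf (xs ++ ys) f ≡ sumOf xs f + sumOf ys f
sumOf-++ xs ys f = trans (cong sum (map-++ f xs ys)) (sum-++ (map f xs) (map f ys))

sumOf-concatMap : {A B : Set} (g : A → List B) (L : List A) (f : B → ℕ) →
  sumOf (concatMap g L) f ≡ sumOf L (λ x → sumOf (g x) f)
sumOf-concatMap g [] f = refl
sumOf-concatMap g (x ∷ L) f =
  trans (sumOf-++ (g x) (concatMap g L) f) (cong (sumOf (g x) f +_) (sumOf-concatMap g L f))

sumOf-map : {A B : Set} (h : A → B) (L : List A) (f : B → ℕ) →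
  sumOf (map h L) f ≡ sumOf L (f ∘ h)
sumOf-map h [] f = refl
sumOf-map h (x ∷ L) f = cong (f (h x) +_) (sumOf-map h L f)

sumOf-cong : {A : Set} (L : List A) {f g : A → ℕ} →
  (∀ {x} → x ∈ L → f x ≡ g x) → sumOf L f ≡ sumOf L g
sumOf-cong [] eq = refl
sumOf-cong (x ∷ L) eq = cong₂ _+_ (eq (here refl)) (sumOf-cong L (eq ∘ there))

sumOf-ext : {A : Set} (L : List A) {f g : A → ℕ} → (∀ x → f x ≡ g x) → sumOf L f ≡ sumOf L g
sumOf-ext L eq = sumOf-cong L (λ {x} _ → eq x)

sumOf-zero : {A : Set} (L : List A) {f : A → ℕ} → (∀ {x} → x ∈ L → f x ≡ 0) → sumOf L f ≡ 0
sumOf-zero [] eq = refl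
sumOf-zero (x ∷ L) eq = cong₂ _+_ (eq (here refl)) (sumOf-zero L (eq ∘ there))

sumOf-+ : {A : Set} (L : List A) (f g : A → ℕ) →
  sumOf L (λ x → f x + g x) ≡ sumOf L f + sumOf L g
sumOf-+ [] f g = refl
sumOf-+ (x ∷ L) f g = trans (cong (f x + g x +_) (sumOf-+ L f g)) (shuffle (f x) (g x) _ _)
  where
  shuffle : ∀ a b c d → a + b + (c + d) ≡ (a + c) + (b + d)
  shuffle = solve-∀

sumOf-*ˡ : {A : Set} (L : List A) (c : ℕ) (f : A → ℕ) → sumOf L (λ x → c * f x) ≡ c * sumOf L f
sumOf-*ˡ [] c f = sym (*-zeroʳ c)
sumOf-*ˡ (x ∷ L) c f = trans (cong (c * f x +_) (sumOf-*ˡ L c f)) (sym (*-distribˡ-+ c (f x) _))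

sumOf-*ʳ : {A : Set} (L : List A) (c : ℕ) (f : A → ℕ) → sumOf L (λ x → f x * c) ≡ sumOf L f * c
sumOf-*ʳ L c f =
  trans (sumOf-ext L (λ x → *-comm (f x) c)) (trans (sumOf-*ˡ L c f) (*-comm c (sumOf L f)))

sumOf-swap : {A B : Set} (L : List A) (L′ : List B) (f : A → B → ℕ) →
  sumOf L (λ a → sumOf L′ (f a)) ≡ sumOf L′ (λ b → sumOf L (λ a → f a b))
sumOf-swap [] L′ f = sym (sumOf-zero L′ (λ _ → refl))
sumOf-swap (x ∷ L) L′ f =
  trans (cong (sumOf L′ (f x) +_) (sumOf-swap L L′ f)) (sym (sumOf-+ L′ (f x) _))

sumOf-↭ : {A : Set} {L L′ : List A} (f : A → ℕ) → L ↭ L′ → sumOf L f ≡ sumOf L′ f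
sumOf-↭ f p = sum-↭ (↭.map⁺ f p)

-- The Kronecker delta δ a b = [a = b], the building block of every count.
-- It is kept opaque so that sums of deltas are manipulated only through
-- the lemmas below.
opaque
  δ : ℕ → ℕ → ℕ
  δ a b = if a ≡ᵇ b then 1 else 0

  δ-yes : ∀ {a b} → a ≡ b → δ a b ≡ 1
  δ-yes {a} {b} a≡b with a ≡ᵇ b in eq
  ... | true = refl
  ... | false = ⊥-elim (subst T eq (≡⇒≡ᵇ a b a≡b))

  δ-no : ∀ {a b} → ¬ a ≡ b → δ a b ≡ 0
  δ-no {a} {b} a≢b with a ≡ᵇ b in eq
  ... | true = ⊥-elim (a≢b (≡ᵇ⇒≡ a b (subst T (sym eq) tt)))
  ... | false = refl

  count≡sumOfδ : {A : Set} (f : A → ℕ) (k : ℕ) (L : List A) →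
    length (filter (λ x → f x ≟ k) L) ≡ sumOf L (λ x → δ (f x) k)
  count≡sumOfδ f k [] = refl
  count≡sumOfδ f k (x ∷ L) with f x ≡ᵇ k
  ... | true = cong suc (count≡sumOfδ f k L)
  ... | false = count≡sumOfδ f k L

δ-refl : ∀ a → δ a a ≡ 1
δ-refl a = δ-yes refl

δ-≡ : ∀ {a b c d} → (a ≡ b → c ≡ d) → (c ≡ d → a ≡ b) → δ a b ≡ δ c d
δ-≡ {a} {b} to from with a ≟ b
... | yes p = trans (δ-yes p) (sym (δ-yes (to p)))
... | no p = trans (δ-no p) (sym (δ-no (p ∘ from)))

δ-suc : ∀ a b → δ (suc a) (suc b) ≡ δ a b
δ-suc a b = δ-≡ suc-injective (cong suc)

sumBelow : ℕ → (ℕ → ℕ) → ℕ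
sumBelow zero f = 0
sumBelow (suc m) f = sumBelow m f + f m

sumOf-upTo : ∀ m (f : ℕ → ℕ) → sumOf (upTo m) f ≡ sumBelow m f
sumOf-upTo zero f = refl
sumOf-upTo (suc m) f = begin
  sumOf (upTo (suc m)) f       ≡⟨ cong (λ L → sumOf L f) (sym (upTo-∷ʳ m)) ⟩
  sumOf (upTo m ∷ʳ m) f        ≡⟨ sumOf-++ (upTo m) (m ∷ []) f ⟩
  sumOf (upTo m) f + (f m + 0) ≡⟨ cong₂ _+_ (sumOf-upTo m f) (+-identityʳ (f m)) ⟩
  sumBelow m f + f m           ∎
  where open ≡-Reasoning

sumBelow-cong : ∀ m {f g} → (∀ i → i < m → f i ≡ g i) → sumBelow m f ≡ sumBelow m g
sumBelow-cong zero eq = refl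
sumBelow-cong (suc m) eq =
  cong₂ _+_ (sumBelow-cong m (λ i i<m → eq i (m<n⇒m<1+n i<m))) (eq m ≤-refl)

sumBelow-zero : ∀ m {f} → (∀ i → i < m → f i ≡ 0) → sumBelow m f ≡ 0
sumBelow-zero m {f} eq = trans (sumBelow-cong m eq) (zeros m)
  where
  zeros : ∀ m → sumBelow m (λ _ → 0) ≡ 0
  zeros zero = refl
  zeros (suc m) = trans (+-identityʳ _) (zeros m)

sumBelow-+ : ∀ m f g → sumBelow m (λ j → f j + g j) ≡ sumBelow m f + sumBelow m g
sumBelow-+ zero f g = refl
sumBelow-+ (suc m) f g =
  trans (cong (_+ (f m + g m)) (sumBelow-+ m f g)) (shuffle (sumBelow m f) (sumBelow m g) (f m) (g m))
  where
  shuffle : ∀ a b c d → a + b + (c + d) ≡ a + c + (b + d)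
  shuffle = solve-∀

sumBelow-shift : ∀ m f → sumBelow (suc m) f ≡ f 0 + sumBelow m (f ∘ suc)
sumBelow-shift zero f = +-comm 0 (f 0)
sumBelow-shift (suc m) f = trans (cong (_+ f (suc m)) (sumBelow-shift m f)) (+-assoc (f 0) _ _)

sumBelow-reverse : ∀ n f → sumBelow (suc n) f ≡ sumBelow (suc n) (λ j → f (n ∸ j))
sumBelow-reverse zero f = refl
sumBelow-reverse (suc n) f = begin
  sumBelow (suc n) f + f (suc n)                   ≡⟨ cong (_+ f (suc n)) (sumBelow-reverse n f) ⟩
  sumBelow (suc n) (λ j → f (n ∸ j)) + f (suc n)   ≡⟨ +-comm _ (f (suc n)) ⟩
  f (suc n) + sumBelow (suc n) (λ j → f (n ∸ j))   ≡⟨ sym (sumBelow-shift (suc n) (λ j → f (suc n ∸ j))) ⟩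
  sumBelow (suc (suc n)) (λ j → f (suc n ∸ j))     ∎
  where open ≡-Reasoning

sumBelow-δ-in : ∀ m x (h : ℕ → ℕ) → x < m → sumBelow m (λ i → δ x i * h i) ≡ h x
sumBelow-δ-out : ∀ m x (h : ℕ → ℕ) → m ≤ x → sumBelow m (λ i → δ x i * h i) ≡ 0
sumBelow-δ-out m x h m≤x =
  sumBelow-zero m (λ i i<m → cong (_* h i) (δ-no (λ x≡i → <⇒≱ i<m (subst (m ≤_) x≡i m≤x))))

sumBelow-δ-in (suc m) x h x<1+m with x ≟ m
... | yes refl = begin
  sumBelow m (λ i → δ x i * h i) + δ x x * h x
    ≡⟨ cong₂ _+_ (sumBelow-δ-out m x h ≤-refl) (cong (_* h x) (δ-refl x)) ⟩
  h x + 0 ≡⟨ +-identityʳ (h x) ⟩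
  h x ∎
  where open ≡-Reasoning
... | no x≢m = begin
  sumBelow m (λ i → δ x i * h i) + δ x m * h m
    ≡⟨ cong₂ _+_ (sumBelow-δ-in m x h (≤∧≢⇒< (≤-pred x<1+m) x≢m)) (cong (_* h m) (δ-no x≢m)) ⟩
  h x + 0 ≡⟨ +-identityʳ (h x) ⟩
  h x ∎
  where open ≡-Reasoning

sumBelow-δ-convolution : ∀ d x y → sumBelow (suc d) (λ i → δ x i * δ y (d ∸ i)) ≡ δ (x + y) d
sumBelow-δ-convolution d x y with x ≤? d
... | yes x≤d = trans (sumBelow-δ-in (suc d) x (λ i → δ y (d ∸ i)) (s≤s x≤d))
  (δ-≡ (λ y≡d-x → trans (cong (x +_) y≡d-x) (m+[n∸m]≡n x≤d))
       (λ x+y≡d → trans (sym (m+n∸m≡n x y)) (cong (_∸ x) x+y≡d)))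
... | no x≰d = trans (sumBelow-δ-out (suc d) x (λ i → δ y (d ∸ i)) (≰⇒> x≰d))
  (sym (δ-no (λ x+y≡d → x≰d (subst (x ≤_) x+y≡d (m≤m+n x y)))))

pascal : ∀ (T : ℕ → ℕ → ℕ) n →
  sumBelow (suc (suc n)) (λ j → (suc n C j) * T j (suc n ∸ j))
  ≡ sumBelow (suc n) (λ j → (n C j) * (T j (suc (n ∸ j)) + T (suc j) (n ∸ j)))
pascal T n = begin
  sumBelow (suc (suc n)) (λ j → (suc n C j) * T j (suc n ∸ j))
    ≡⟨ sumBelow-shift (suc n) _ ⟩
  1 * T 0 (suc n) + sumBelow (suc n) (λ j → (suc n C suc j) * T (suc j) (n ∸ j))
    ≡⟨ cong (1 * T 0 (suc n) +_) (trans (sumBelow-cong (suc n) (λ j _ → split j)) (sumBelow-+ (suc n) _ _)) ⟩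
  1 * T 0 (suc n) + (sumBelow (suc n) upper + sumBelow (suc n) lower)
    ≡⟨ sym (+-assoc (1 * T 0 (suc n)) _ _) ⟩
  (1 * T 0 (suc n) + sumBelow (suc n) upper) + sumBelow (suc n) lower
    ≡⟨ cong (_+ sumBelow (suc n) lower) upper-reindexed ⟩
  sumBelow (suc n) (λ j → (n C j) * T j (suc (n ∸ j))) + sumBelow (suc n) lower
    ≡⟨ sym (trans (sumBelow-cong (suc n) (λ j _ → *-distribˡ-+ (n C j) _ _)) (sumBelow-+ (suc n) _ _)) ⟩
  sumBelow (suc n) (λ j → (n C j) * (T j (suc (n ∸ j)) + T (suc j) (n ∸ j))) ∎
  where
  open ≡-Reasoning
  upper lower : ℕ → ℕ
  upper j = (n C suc j) * T (suc j) (n ∸ j)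
  lower j = (n C j) * T (suc j) (n ∸ j)
  split : ∀ j → (suc n C suc j) * T (suc j) (n ∸ j) ≡ upper j + lower j
  split j = trans (cong (_* T (suc j) (n ∸ j)) (trans (sym (nCk+nC[k+1]≡[n+1]C[k+1] n j)) (+-comm (n C j) (n C suc j))))
                  (*-distribʳ-+ (T (suc j) (n ∸ j)) (n C suc j) (n C j))
  g : ℕ → ℕ
  g j = (n C j) * T j (suc n ∸ j)
  upper-reindexed : 1 * T 0 (suc n) + sumBelow (suc n) upper ≡ sumBelow (suc n) (λ j → (n C j) * T j (suc (n ∸ j)))
  upper-reindexed = begin
    1 * T 0 (suc n) + sumBelow (suc n) upper ≡⟨ sym (sumBelow-shift (suc n) g) ⟩
    sumBelow (suc n) g + g (suc n)           ≡⟨ cong (sumBelow (suc n) g +_) (cong (_* T (suc n) (n ∸ n)) (k>n⇒nCk≡0 (n<1+n n))) ⟩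
    sumBelow (suc n) g + 0                   ≡⟨ +-identityʳ _ ⟩
    sumBelow (suc n) g                       ≡⟨ sumBelow-cong (suc n) (λ j j≤n → cong (λ e → (n C j) * T j e) (+-∸-assoc 1 (≤-pred j≤n))) ⟩
    sumBelow (suc n) (λ j → (n C j) * T j (suc (n ∸ j))) ∎

-- the symmetry C(n,j) = C(n,n-j): Σ_j C(n,j) f (n-j) j = Σ_k C(n,k) f k (n-k)
sumBelow-binomial-reflect : ∀ n (f : ℕ → ℕ → ℕ) →
  sumBelow (suc n) (λ j → (n C j) * f (n ∸ j) j) ≡ sumBelow (suc n) (λ k → (n C k) * f k (n ∸ k))
sumBelow-binomial-reflect n f = begin
  sumBelow (suc n) (λ j → (n C j) * f (n ∸ j) j)
    ≡⟨ sumBelow-cong (suc n) (λ j j≤n → cong₂ (λ c i → c * f (n ∸ j) i) (nCk≡nC[n∸k] (≤-pred j≤n)) (sym (m∸[m∸n]≡n (≤-pred j≤n)))) ⟩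
  sumBelow (suc n) (λ j → (n C (n ∸ j)) * f (n ∸ j) (n ∸ (n ∸ j)))
    ≡⟨ sym (sumBelow-reverse n (λ k → (n C k) * f k (n ∸ k))) ⟩
  sumBelow (suc n) (λ k → (n C k) * f k (n ∸ k)) ∎
  where open ≡-Reasoning

IsGenPoly : {A : Set} → Poly → List A → (A → ℕ) → Set
IsGenPoly p L f = ∀ e → p e ≡ sumOf L (λ a → δ (f a) e)

⊛-genPoly : {A B : Set} {L : List A} {L′ : List B} {f : A → ℕ} {g : B → ℕ} {p q : Poly} →
  IsGenPoly p L f → IsGenPoly q L′ g →
  ∀ d → (p ⊛ q) d ≡ sumOf L (λ a → sumOf L′ (λ b → δ (f a + g b) d))
⊛-genPoly {L = L} {L′} {f} {g} {p} {q} hp hq d = begin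
  (p ⊛ q) d
    ≡⟨ sumOf-upTo (suc d) _ ⟩
  sumBelow (suc d) (λ i → p i * q (d ∸ i))
    ≡⟨ sumBelow-cong (suc d) (λ i _ → trans (cong₂ _*_ (hp i) (hq (d ∸ i))) (expand i)) ⟩
  sumBelow (suc d) (λ i → sumOf L (λ a → sumOf L′ (λ b → δ (f a) i * δ (g b) (d ∸ i))))
    ≡⟨ sym (sumOf-upTo (suc d) _) ⟩
  sumOf (upTo (suc d)) (λ i → sumOf L (λ a → sumOf L′ (λ b → δ (f a) i * δ (g b) (d ∸ i))))
    ≡⟨ sumOf-swap (upTo (suc d)) L _ ⟩
  sumOf L (λ a → sumOf (upTo (suc d)) (λ i → sumOf L′ (λ b → δ (f a) i * δ (g b) (d ∸ i))))
    ≡⟨ sumOf-ext L (λ a → sumOf-swap (upTo (suc d)) L′ _) ⟩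
  sumOf L (λ a → sumOf L′ (λ b → sumOf (upTo (suc d)) (λ i → δ (f a) i * δ (g b) (d ∸ i))))
    ≡⟨ sumOf-ext L (λ a → sumOf-ext L′ (λ b →
         trans (sumOf-upTo (suc d) _) (sumBelow-δ-convolution d (f a) (g b)))) ⟩
  sumOf L (λ a → sumOf L′ (λ b → δ (f a + g b) d)) ∎
  where
  open ≡-Reasoning
  expand : ∀ i → sumOf L (λ a → δ (f a) i) * sumOf L′ (λ b → δ (g b) (d ∸ i))
               ≡ sumOf L (λ a → sumOf L′ (λ b → δ (f a) i * δ (g b) (d ∸ i)))
  expand i = trans (sym (sumOf-*ʳ L _ (λ a → δ (f a) i)))
                   (sumOf-ext L (λ a → sym (sumOf-*ˡ L′ (δ (f a) i) _)))

atSquare-genPoly : {A : Set} {L : List A} {g : A → ℕ} {p : Poly} →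
  IsGenPoly p L g → IsGenPoly (atSquare p) L (λ b → 2 * g b)
atSquare-genPoly {L = L} {g} hp d with d % 2 ≟ 0
... | yes d-even = trans (hp (d / 2)) (sumOf-ext L (λ b →
  δ-≡ (λ g≡d/2 → trans (cong (2 *_) g≡d/2) (sym d≡2[d/2]))
      (λ 2g≡d → *-cancelˡ-≡ (g b) (d / 2) 2 (trans 2g≡d d≡2[d/2]))))
  where
  d≡2[d/2] : d ≡ 2 * (d / 2)
  d≡2[d/2] = trans (m≡m%n+[m/n]*n d 2) (trans (cong (_+ (d / 2) * 2) d-even) (*-comm (d / 2) 2))
... | no d-odd = sym (sumOf-zero L (λ {b} _ → δ-no (λ 2g≡d → d-odd (begin
  d % 2           ≡⟨ cong (_% 2) (sym 2g≡d) ⟩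
  (2 * g b) % 2   ≡⟨ cong (_% 2) (*-comm 2 (g b)) ⟩
  (g b * 2) % 2   ≡⟨ m*n%n≡0 (g b) 2 ⟩
  0               ∎))))
  where open ≡-Reasoning

onePlusX⊛-zero : ∀ p → (onePlusX ⊛ p) 0 ≡ p 0
onePlusX⊛-zero p = trans (+-identityʳ _) (*-identityˡ (p 0))

onePlusX⊛-suc : ∀ p d → (onePlusX ⊛ p) (suc d) ≡ p (suc d) + p d
onePlusX⊛-suc p d = begin
  (onePlusX ⊛ p) (suc d)                         ≡⟨ sumOf-upTo (suc (suc d)) _ ⟩
  sumBelow (suc (suc d)) f                       ≡⟨ sumBelow-shift (suc d) f ⟩
  f 0 + sumBelow (suc d) (f ∘ suc)               ≡⟨ cong (f 0 +_) (sumBelow-shift d (f ∘ suc)) ⟩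
  f 0 + (f 1 + sumBelow d (f ∘ suc ∘ suc))       ≡⟨ cong (λ e → f 0 + (f 1 + e)) (sumBelow-zero d (λ _ _ → refl)) ⟩
  f 0 + (f 1 + 0)                                ≡⟨ cong₂ (λ x y → x + (y + 0)) (*-identityˡ (p (suc d))) (*-identityˡ (p d)) ⟩
  p (suc d) + (p d + 0)                          ≡⟨ cong (p (suc d) +_) (+-identityʳ (p d)) ⟩
  p (suc d) + p d                                ∎
  where
  open ≡-Reasoning
  f : ℕ → ℕ
  f i = onePlusX i * p (suc d ∸ i)

onePlusX⊛-genPoly : {A : Set} {L : List A} {f : A → ℕ} {p : Poly} → IsGenPoly p L f →
  ∀ e → (onePlusX ⊛ p) e ≡ sumOf L (λ a → δ (f a) e) + sumOf L (λ a → δ (suc (f a)) e)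
onePlusX⊛-genPoly {L = L} {f} {p} hp zero = begin
  (onePlusX ⊛ p) 0                                        ≡⟨ trans (onePlusX⊛-zero p) (hp 0) ⟩
  sumOf L (λ a → δ (f a) 0)                                ≡⟨ sym (+-identityʳ _) ⟩
  sumOf L (λ a → δ (f a) 0) + 0                            ≡⟨ cong (sumOf L (λ a → δ (f a) 0) +_) (sym (sumOf-zero L (λ _ → δ-no (λ ())))) ⟩
  sumOf L (λ a → δ (f a) 0) + sumOf L (λ a → δ (suc (f a)) 0) ∎
  where open ≡-Reasoning
onePlusX⊛-genPoly {L = L} {f} {p} hp (suc d) = begin
  (onePlusX ⊛ p) (suc d)                                  ≡⟨ onePlusX⊛-suc p d ⟩
  p (suc d) + p d                                          ≡⟨ cong₂ _+_ (hp (suc d)) (hp d) ⟩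
  sumOf L (λ a → δ (f a) (suc d)) + sumOf L (λ a → δ (f a) d) ≡⟨ cong (sumOf L (λ a → δ (f a) (suc d)) +_) (sumOf-ext L (λ a → sym (δ-suc (f a) d))) ⟩
  sumOf L (λ a → δ (f a) (suc d)) + sumOf L (λ a → δ (suc (f a)) (suc d)) ∎
  where open ≡-Reasoning

InRange : ℕ → ℕ → Set
InRange n a = 0 < a × a ≤ n

IsPerm : ℕ → List ℕ → Set
IsPerm n π = Unique π × length π ≡ n × All (InRange n) π

words-∈⁻ : ∀ l n {w} → w ∈ words l n → length w ≡ l × All (InRange n) w
words-∈⁻ zero n (here refl) = refl , []
words-∈⁻ (suc l) n w∈ with find (∈-concatMap⁻ (λ a → map (a ∷_) (words l n)) {xs = map suc (upTo n)} w∈)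
... | a , a∈ , w∈′ with ∈-map⁻ suc a∈ | ∈-map⁻ (a ∷_) w∈′
...   | i , i∈ , refl | w′ , w′∈ , refl with words-∈⁻ l n w′∈
...     | len , inRange = cong suc len , ((s≤s z≤n , ∈-upTo⁻ i∈) ∷ inRange)

words-∈⁺ : ∀ l n {w} → length w ≡ l → All (InRange n) w → w ∈ words l n
words-∈⁺ zero n {[]} refl [] = here refl
words-∈⁺ (suc l) n {suc a ∷ w} len ((_ , a<n) ∷ inRange) =
  ∈-concatMap⁺ (λ b → map (b ∷_) (words l n))
    (lose (∈-map⁺ suc (∈-upTo⁺ a<n)) (∈-map⁺ (suc a ∷_) (words-∈⁺ l n (suc-injective len) inRange)))

perms-∈⁻ : ∀ n {π} → π ∈ perms n → IsPerm n π
perms-∈⁻ n π∈ with ∈-filter⁻ unique? π∈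
... | π∈words , uniq with words-∈⁻ n n π∈words
...   | len , inRange = uniq , len , inRange

perms-∈⁺ : ∀ n {π} → IsPerm n π → π ∈ perms n
perms-∈⁺ n (uniq , len , inRange) = ∈-filter⁺ unique? (words-∈⁺ n n len inRange) uniq

perms-unique : ∀ n → Unique (perms n)
perms-unique n = Unique.filter⁺ unique? (words-unique n n)
  where
  words-unique : ∀ l n → Unique (words l n)
  words-unique zero n = [] ∷ []
  words-unique (suc l) n = Unique.concat⁺
    (All.map⁺ (All.tabulate (λ _ → Unique.map⁺ ∷-injectiveʳ (words-unique l n))))
    (AllPairs.map⁺ (AllPairs.map disjoint (Unique.map⁺ suc-injective (Unique.upTo⁺ n))))
    where
    disjoint : ∀ {a b} → ¬ a ≡ b → Disjoint (map (a ∷_) (words l n)) (map (b ∷_) (words l n))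
    disjoint a≢b (w∈ , w∈′) with ∈-map⁻ _ w∈ | ∈-map⁻ _ w∈′
    ... | _ , _ , refl | _ , _ , eq = a≢b (proj₁ (∷-injective eq))

All-mid⁻ : ∀ {P : ℕ → Set} σ {M τ} → All P (σ ++ M ∷ τ) → All P (σ ++ τ) × P M
All-mid⁻ σ h with All.++⁻ σ h
... | hσ , hM ∷ hτ = All.++⁺ hσ hτ , hM

All-mid⁺ : ∀ {P : ℕ → Set} σ {M τ} → All P (σ ++ τ) → P M → All P (σ ++ M ∷ τ)
All-mid⁺ σ h hM with All.++⁻ σ h
... | hσ , hτ = All.++⁺ hσ (hM ∷ hτ)

length-mid : ∀ σ {M : ℕ} {τ} → length (σ ++ M ∷ τ) ≡ suc (length (σ ++ τ))
length-mid [] = refl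
length-mid (a ∷ σ) = cong suc (length-mid σ)

Unique-mid⁻ : ∀ σ {M τ} → Unique (σ ++ M ∷ τ) → Unique (σ ++ τ) × M ∉ σ ++ τ
Unique-mid⁻ [] (M∉τ ∷ uniq) = uniq , (λ M∈ → All.lookup M∉τ M∈ refl)
Unique-mid⁻ (a ∷ σ) (a∉ ∷ uniq) with Unique-mid⁻ σ uniq | All-mid⁻ σ a∉
... | uniq′ , M∉ | a∉′ , a≢M = (a∉′ ∷ uniq′) , λ { (here M≡a) → a≢M (sym M≡a) ; (there M∈) → M∉ M∈ }

Unique-mid⁺ : ∀ σ {M τ} → Unique (σ ++ τ) → M ∉ σ ++ τ → Unique (σ ++ M ∷ τ)
Unique-mid⁺ [] {M} {τ} uniq M∉ = All.tabulate (λ x∈ M≡x → M∉ (subst (_∈ τ) (sym M≡x) x∈)) ∷ uniq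
Unique-mid⁺ (a ∷ σ) (a∉ ∷ uniq) M∉ =
  All-mid⁺ σ a∉ (λ a≡M → M∉ (here (sym a≡M))) ∷ Unique-mid⁺ σ uniq (M∉ ∘ there)

Unique-prefix : ∀ σ {τ : List ℕ} → Unique (σ ++ τ) → Unique σ
Unique-prefix [] _ = []
Unique-prefix (a ∷ σ) (a∉ ∷ uniq) = All.++⁻ˡ σ a∉ ∷ Unique-prefix σ uniq

lower : ∀ {m xs} → All (InRange (suc m)) xs → suc m ∉ xs → All (InRange m) xs
lower inRange m+1∉ = All.tabulate (λ x∈ → let (0<x , x≤m+1) = All.lookup inRange x∈ in
  0<x , ≤-pred (≤∧≢⇒< x≤m+1 (λ x≡m+1 → m+1∉ (subst (_∈ _) x≡m+1 x∈))))

raise : ∀ {n a} → InRange n a → InRange (suc n) a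
raise (0<a , a≤n) = 0<a , m≤n⇒m≤1+n a≤n

InRange⇒≢top : ∀ {n xs} → All (InRange n) xs → suc n ∉ xs
InRange⇒≢top inRange n+1∈ = <⇒≱ ≤-refl (proj₂ (All.lookup inRange n+1∈))

pigeonhole : ∀ m {π} → Unique π → All (InRange m) π → length π ≤ m
pigeonhole zero {[]} _ _ = z≤n
pigeonhole zero {a ∷ π} _ ((0<a , a≤0) ∷ _) = ⊥-elim (<⇒≱ 0<a a≤0)
pigeonhole (suc m) {π} uniq inRange with suc m ∈? π
... | no m+1∉ = m≤n⇒m≤1+n (pigeonhole m uniq (lower inRange m+1∉))
... | yes m+1∈ with ∈-∃++ m+1∈
...   | σ , τ , refl with Unique-mid⁻ σ uniq | All-mid⁻ σ inRange
...     | uniq′ , m+1∉ | inRange′ , _ =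
  subst (_≤ suc m) (sym (length-mid σ)) (s≤s (pigeonhole m uniq′ (lower inRange′ m+1∉)))

insertions : ℕ → List ℕ → List (List ℕ)
insertions M [] = (M ∷ []) ∷ []
insertions M (a ∷ w) = (M ∷ a ∷ w) ∷ map (a ∷_) (insertions M w)

insertions-∈⁻ : ∀ M ρ {π} → π ∈ insertions M ρ → ∃₂ λ σ τ → ρ ≡ σ ++ τ × π ≡ σ ++ M ∷ τ
insertions-∈⁻ M [] (here refl) = [] , [] , refl , refl
insertions-∈⁻ M (a ∷ w) (here refl) = [] , a ∷ w , refl , refl
insertions-∈⁻ M (a ∷ w) (there π∈) with ∈-map⁻ (a ∷_) π∈
... | π′ , π′∈ , refl with insertions-∈⁻ M w π′∈
...   | σ , τ , refl , refl = a ∷ σ , τ , refl , refl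

insertions-∈⁺ : ∀ M σ τ → σ ++ M ∷ τ ∈ insertions M (σ ++ τ)
insertions-∈⁺ M [] [] = here refl
insertions-∈⁺ M [] (a ∷ τ) = here refl
insertions-∈⁺ M (a ∷ σ) τ = there (∈-map⁺ (a ∷_) (insertions-∈⁺ M σ τ))

insertions-unique : ∀ M ρ → M ∉ ρ → Unique (insertions M ρ)
insertions-unique M [] _ = [] ∷ []
insertions-unique M (a ∷ w) M∉ =
  All.tabulate head-new ∷ Unique.map⁺ ∷-injectiveʳ (insertions-unique M w (M∉ ∘ there))
  where
  head-new : ∀ {x} → x ∈ map (a ∷_) (insertions M w) → ¬ (M ∷ a ∷ w) ≡ x
  head-new x∈ eq with ∈-map⁻ (a ∷_) x∈
  ... | _ , _ , refl = M∉ (here (proj₁ (∷-injective eq)))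

split-unique : ∀ {M : ℕ} σ σ′ {τ τ′} → M ∉ σ → M ∉ σ′ → σ ++ M ∷ τ ≡ σ′ ++ M ∷ τ′ → σ ≡ σ′ × τ ≡ τ′
split-unique [] [] _ _ eq = refl , proj₂ (∷-injective eq)
split-unique [] (b ∷ σ′) _ M∉σ′ eq = ⊥-elim (M∉σ′ (here (proj₁ (∷-injective eq))))
split-unique (a ∷ σ) [] M∉σ _ eq = ⊥-elim (M∉σ (here (sym (proj₁ (∷-injective eq)))))
split-unique (a ∷ σ) (b ∷ σ′) M∉σ M∉σ′ eq with ∷-injective eq
... | refl , eq′ with split-unique σ σ′ (M∉σ ∘ there) (M∉σ′ ∘ there) eq′
...   | refl , refl = refl , refl

insertions-injective : ∀ M ρ ρ′ {π} → M ∉ ρ → M ∉ ρ′ → π ∈ insertions M ρ → π ∈ insertions M ρ′ → ρ ≡ ρ′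
insertions-injective M ρ ρ′ M∉ρ M∉ρ′ π∈ π∈′ with insertions-∈⁻ M ρ π∈ | insertions-∈⁻ M ρ′ π∈′
... | σ , τ , refl , refl | σ′ , τ′ , refl , eq
  with split-unique σ σ′ (M∉ρ ∘ ∈-++⁺ˡ) (M∉ρ′ ∘ ∈-++⁺ˡ) eq
...   | refl , refl = refl

-- 𝔖 n lists the permutations of [n], each obtained from one of [n-1] by
-- inserting the letter n; this is the enumeration the arguments recurse on
𝔖 : ℕ → List (List ℕ)
𝔖 zero = [] ∷ []
𝔖 (suc n) = concatMap (insertions (suc n)) (𝔖 n)

𝔖-∈⁻ : ∀ n {π} → π ∈ 𝔖 n → IsPerm n π
𝔖-∈⁻ zero (here refl) = [] , refl , []
𝔖-∈⁻ (suc n) π∈ with find (∈-concatMap⁻ (insertions (suc n)) {xs = 𝔖 n} π∈)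
... | ρ , ρ∈ , π∈′ with 𝔖-∈⁻ n ρ∈ | insertions-∈⁻ (suc n) ρ π∈′
...   | uniq , len , inRange | σ , τ , refl , refl =
  Unique-mid⁺ σ uniq (InRange⇒≢top inRange) ,
  trans (length-mid σ) (cong suc len) ,
  All-mid⁺ σ (All.map raise inRange) (s≤s z≤n , ≤-refl)

𝔖-∈⁺ : ∀ n {π} → IsPerm n π → π ∈ 𝔖 n
𝔖-∈⁺ zero {[]} _ = here refl
𝔖-∈⁺ (suc n) {π} (uniq , len , inRange) with suc n ∈? π
... | no n+1∉ = ⊥-elim (<⇒≱ (subst (n <_) (sym len) ≤-refl) (pigeonhole n uniq (lower inRange n+1∉)))
... | yes n+1∈ with ∈-∃++ n+1∈
...   | σ , τ , refl with Unique-mid⁻ σ uniq | All-mid⁻ σ inRange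
...     | uniq′ , n+1∉ | inRange′ , _ =
  ∈-concatMap⁺ (insertions (suc n))
    (lose (𝔖-∈⁺ n (uniq′ , suc-injective (trans (sym (length-mid σ)) len) , lower inRange′ n+1∉))
          (insertions-∈⁺ (suc n) σ τ))

𝔖-inRange : ∀ {n π} → π ∈ 𝔖 n → All (InRange n) π
𝔖-inRange π∈ = proj₂ (proj₂ (𝔖-∈⁻ _ π∈))

𝔖-length : ∀ {n π} → π ∈ 𝔖 n → length π ≡ n
𝔖-length π∈ = proj₁ (proj₂ (𝔖-∈⁻ _ π∈))

AllPairs-restrict : {A : Set} {P : A → Set} {R R′ : A → A → Set} {xs : List A} →
  All P xs → AllPairs R xs → (∀ {x y} → P x → P y → R x y → R′ x y) → AllPairs R′ xs
AllPairs-restrict [] [] upgrade = []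
AllPairs-restrict (px ∷ pxs) (rx ∷ rxs) upgrade = go pxs rx ∷ AllPairs-restrict pxs rxs upgrade
  where
  go : ∀ {ys} → All _ ys → All _ ys → All _ ys
  go [] [] = []
  go (py ∷ pys) (r ∷ rs) = upgrade px py r ∷ go pys rs

𝔖-unique : ∀ n → Unique (𝔖 n)
𝔖-unique zero = [] ∷ []
𝔖-unique (suc n) = Unique.concat⁺
  (All.map⁺ (All.tabulate (λ {ρ} ρ∈ → insertions-unique (suc n) ρ (top∉ ρ∈))))
  (AllPairs.map⁺ (AllPairs-restrict (All.tabulate top∉) (𝔖-unique n)
    (λ {ρ} {ρ′} n+1∉ρ n+1∉ρ′ ρ≢ρ′ (π∈ , π∈′) → ρ≢ρ′ (insertions-injective (suc n) ρ ρ′ n+1∉ρ n+1∉ρ′ π∈ π∈′))))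
  where
  top∉ : ∀ {ρ} → ρ ∈ 𝔖 n → suc n ∉ ρ
  top∉ ρ∈ = InRange⇒≢top (𝔖-inRange ρ∈)

perms↭𝔖 : ∀ n → perms n ↭ 𝔖 n
perms↭𝔖 n = ∼bag⇒↭ (unique∧set⇒bag (perms-unique n) (𝔖-unique n)
  (mk⇔ (𝔖-∈⁺ n ∘ perms-∈⁻ n) (perms-∈⁺ n ∘ 𝔖-∈⁻ n)))

sumOf-perms : ∀ n (f : List ℕ → ℕ) → sumOf (perms n) f ≡ sumOf (𝔖 n) f
sumOf-perms n f = sumOf-↭ f (perms↭𝔖 n)

<ᵇ-true : ∀ {a b} → a < b → (a <ᵇ b) ≡ true
<ᵇ-true {a} {b} a<b with a <ᵇ b in eq
... | true = refl
... | false = ⊥-elim (subst T eq (<⇒<ᵇ a<b))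

<ᵇ-false : ∀ {a b} → ¬ a < b → (a <ᵇ b) ≡ false
<ᵇ-false {a} {b} a≮b with a <ᵇ b in eq
... | true = ⊥-elim (a≮b (<ᵇ⇒< a b (subst T (sym eq) tt)))
... | false = refl

bit : Bool → ℕ
bit b = if b then 1 else 0

-- Order-isomorphism invariance.  A list of pairs (a , a′) describes two words
-- letter by letter; if consecutive letters compare in the same way in both
-- words, they have the same direction changes and peaks, and if they compare
-- in opposite ways, they still have the same direction changes.
Pair : Set
Pair = ℕ × ℕ

SameOrder OppositeOrder : Pair → Pair → Set
SameOrder (a , a′) (b , b′) = (a <ᵇ b) ≡ (a′ <ᵇ b′) × (b <ᵇ a) ≡ (b′ <ᵇ a′)
OppositeOrder (a , a′) (b , b′) = (a <ᵇ b) ≡ (b′ <ᵇ a′) × (b <ᵇ a) ≡ (a′ <ᵇ b′)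

Adjacent : (Pair → Pair → Set) → List Pair → Set
Adjacent R (p ∷ q ∷ Z) = R p q × Adjacent R (q ∷ Z)
Adjacent R _ = ⊤

fsts snds : List Pair → List ℕ
fsts = map proj₁
snds = map proj₂

dirChanges-sameOrder : ∀ Z → Adjacent SameOrder Z → dirChanges (fsts Z) ≡ dirChanges (snds Z)
dirChanges-sameOrder [] _ = refl
dirChanges-sameOrder (p ∷ []) _ = refl
dirChanges-sameOrder (p ∷ q ∷ []) _ = refl
dirChanges-sameOrder ((a , a′) ∷ (b , b′) ∷ (c , c′) ∷ Z) ((ab , ba) , (bc , cb) , rest) =
  cong₂ _+_ (cong bit turn) (dirChanges-sameOrder ((b , b′) ∷ (c , c′) ∷ Z) ((bc , cb) , rest))
  where
  turn : changesDir a b c ≡ changesDir a′ b′ c′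
  turn rewrite ab | ba | bc | cb = refl

interiorPeaks-sameOrder : ∀ Z → Adjacent SameOrder Z → interiorPeaks (fsts Z) ≡ interiorPeaks (snds Z)
interiorPeaks-sameOrder [] _ = refl
interiorPeaks-sameOrder (p ∷ []) _ = refl
interiorPeaks-sameOrder (p ∷ q ∷ []) _ = refl
interiorPeaks-sameOrder ((a , a′) ∷ (b , b′) ∷ (c , c′) ∷ Z) ((ab , _) , (bc , cb) , rest) =
  cong₂ _+_ (cong bit peak) (interiorPeaks-sameOrder ((b , b′) ∷ (c , c′) ∷ Z) ((bc , cb) , rest))
  where
  peak : ((a <ᵇ b) ∧ (c <ᵇ b)) ≡ ((a′ <ᵇ b′) ∧ (c′ <ᵇ b′))
  peak rewrite ab | cb = refl

dirChanges-oppositeOrder : ∀ Z → Adjacent OppositeOrder Z → dirChanges (fsts Z) ≡ dirChanges (snds Z)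
dirChanges-oppositeOrder [] _ = refl
dirChanges-oppositeOrder (p ∷ []) _ = refl
dirChanges-oppositeOrder (p ∷ q ∷ []) _ = refl
dirChanges-oppositeOrder ((a , a′) ∷ (b , b′) ∷ (c , c′) ∷ Z) ((ab , ba) , (bc , cb) , rest) =
  cong₂ _+_ (cong bit turn) (dirChanges-oppositeOrder ((b , b′) ∷ (c , c′) ∷ Z) ((bc , cb) , rest))
  where
  turn : changesDir a b c ≡ changesDir a′ b′ c′
  turn rewrite ab | ba | bc | cb = ∨-comm ((b′ <ᵇ a′) ∧ (b′ <ᵇ c′)) ((a′ <ᵇ b′) ∧ (c′ <ᵇ b′))

graph : (ℕ → ℕ) → List ℕ → List Pair
graph h w = map (λ a → a , h a) w

fsts-graph : ∀ h w → fsts (graph h w) ≡ w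
fsts-graph h [] = refl
fsts-graph h (a ∷ w) = cong (a ∷_) (fsts-graph h w)

snds-graph : ∀ h w → snds (graph h w) ≡ map h w
snds-graph h [] = refl
snds-graph h (a ∷ w) = cong (h a ∷_) (snds-graph h w)

Adjacent-graph : ∀ {R : Pair → Pair → Set} → (∀ p → R p p) → (∀ {p q} → R p q → R q p) →
  ∀ c h w → (∀ {a b} → a ∈ w → b ∈ w → R (a , h a) (b , h b)) → (∀ {a} → a ∈ w → R c (a , h a)) →
  Adjacent R (c ∷ graph h w)
Adjacent-graph {R} R-refl R-sym c h w inside first = adjacent (c ∷ graph h w) related
  where
  adjacent : ∀ Z → (∀ {p q} → p ∈ Z → q ∈ Z → R p q) → Adjacent R Z
  adjacent [] _ = tt
  adjacent (p ∷ []) _ = tt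
  adjacent (p ∷ q ∷ Z) rel = rel (here refl) (there (here refl)) , adjacent (q ∷ Z) (λ p∈ q∈ → rel (there p∈) (there q∈))
  onGraph : ∀ {p} → p ∈ graph h w → ∃ λ a → a ∈ w × p ≡ (a , h a)
  onGraph p∈ with ∈-map⁻ (λ a → a , h a) p∈
  ... | a , a∈ , eq = a , a∈ , eq
  related : ∀ {p q} → p ∈ c ∷ graph h w → q ∈ c ∷ graph h w → R p q
  related (here refl) (here refl) = R-refl c
  related (here refl) (there q∈) with onGraph q∈
  ... | b , b∈ , refl = first b∈
  related (there p∈) (here refl) with onGraph p∈
  ... | a , a∈ , refl = R-sym (first a∈)
  related (there p∈) (there q∈) with onGraph p∈ | onGraph q∈
  ... | a , a∈ , refl | b , b∈ , refl = inside a∈ b∈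

SameOrder-refl : ∀ p → SameOrder p p
SameOrder-refl (a , a′) = trans (<ᵇ-false (n≮n a)) (sym (<ᵇ-false (n≮n a′))) ,
                          trans (<ᵇ-false (n≮n a)) (sym (<ᵇ-false (n≮n a′)))

OppositeOrder-refl : ∀ p → OppositeOrder p p
OppositeOrder-refl = SameOrder-refl

SameOrder-sym : ∀ {p q} → SameOrder p q → SameOrder q p
SameOrder-sym {_ , _} {_ , _} (x , y) = y , x

OppositeOrder-sym : ∀ {p q} → OppositeOrder p q → OppositeOrder q p
OppositeOrder-sym {_ , _} {_ , _} (x , y) = y , x

-- Standardization: replace each letter of w by its rank 1, 2, … among the
-- letters of w.  This is order preserving on the letters of w.
below : ℕ → List ℕ → ℕ
below a [] = 0
below a (b ∷ w) = bit (b <ᵇ a) + below a w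

rank : List ℕ → ℕ → ℕ
rank w a = suc (below a w)

std : List ℕ → List ℕ
std w = map (rank w) w

bit-<ᵇ-mono : ∀ {a b} c → a ≤ b → bit (c <ᵇ a) ≤ bit (c <ᵇ b)
bit-<ᵇ-mono {a} {b} c a≤b with c <? a
... | yes c<a rewrite <ᵇ-true c<a | <ᵇ-true (<-≤-trans c<a a≤b) = ≤-refl
... | no c≮a rewrite <ᵇ-false c≮a = z≤n

below-mono : ∀ {a b} w → a ≤ b → below a w ≤ below b w
below-mono [] _ = z≤n
below-mono (c ∷ w) a≤b = +-mono-≤ (bit-<ᵇ-mono c a≤b) (below-mono w a≤b)

below-strict : ∀ {a b w} → a < b → a ∈ w → below a w < below b w
below-strict {a} {b} {c ∷ w} a<b (here refl) rewrite <ᵇ-false (n≮n a) | <ᵇ-true a<b =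
  s≤s (below-mono w (<⇒≤ a<b))
below-strict {a} {b} {c ∷ w} a<b (there a∈) = +-mono-≤-< (bit-<ᵇ-mono c (<⇒≤ a<b)) (below-strict a<b a∈)

below-≤-length : ∀ a w → below a w ≤ length w
below-≤-length a [] = z≤n
below-≤-length a (b ∷ w) with b <ᵇ a
... | true = s≤s (below-≤-length a w)
... | false = m≤n⇒m≤1+n (below-≤-length a w)

below-<-length : ∀ {a w} → a ∈ w → below a w < length w
below-<-length {a} {b ∷ w} (here refl) rewrite <ᵇ-false (n≮n a) = s≤s (below-≤-length a w)
below-<-length {a} {b ∷ w} (there a∈) with b <ᵇ a
... | true = s≤s (below-<-length a∈)
... | false = m≤n⇒m≤1+n (below-<-length a∈)

rank-<ᵇ : ∀ {w a b} → a ∈ w → b ∈ w → (a <ᵇ b) ≡ (rank w a <ᵇ rank w b)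
rank-<ᵇ {w} {a} {b} a∈ b∈ with a <? b
... | yes a<b = trans (<ᵇ-true a<b) (sym (<ᵇ-true (s≤s (below-strict a<b a∈))))
... | no a≮b = trans (<ᵇ-false a≮b) (sym (<ᵇ-false (λ r → <⇒≱ (≤-pred r) (below-mono w (≮⇒≥ a≮b)))))

rank-sameOrder : ∀ {w a b} → a ∈ w → b ∈ w → SameOrder (a , rank w a) (b , rank w b)
rank-sameOrder a∈ b∈ = rank-<ᵇ a∈ b∈ , rank-<ᵇ b∈ a∈

leftPeaks-std : ∀ σ → All (0 <_) σ → leftPeaks (std σ) ≡ leftPeaks σ
leftPeaks-std σ positive = begin
  interiorPeaks (0 ∷ map (rank σ) σ)                ≡⟨ cong (interiorPeaks ∘ (0 ∷_)) (sym (snds-graph (rank σ) σ)) ⟩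
  interiorPeaks (snds ((0 , 0) ∷ graph (rank σ) σ)) ≡⟨ sym (interiorPeaks-sameOrder _ same) ⟩
  interiorPeaks (fsts ((0 , 0) ∷ graph (rank σ) σ)) ≡⟨ cong (interiorPeaks ∘ (0 ∷_)) (fsts-graph (rank σ) σ) ⟩
  interiorPeaks (0 ∷ σ)                             ∎
  where
  open ≡-Reasoning
  zero-below : ∀ {a} → 0 < a → SameOrder (0 , 0) (a , rank σ a)
  zero-below {suc a} _ = refl , refl
  same : Adjacent SameOrder ((0 , 0) ∷ graph (rank σ) σ)
  same = Adjacent-graph SameOrder-refl (λ {p} {q} → SameOrder-sym {p} {q}) (0 , 0) (rank σ) σ
           rank-sameOrder (λ a∈ → zero-below (All.lookup positive a∈))

topRuns : ℕ → List ℕ → ℕ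
topRuns N [] = 0
topRuns N (t ∷ τ) = altRuns (N ∷ t ∷ τ)

topRuns-std : ∀ N τ → All (_< N) τ → length τ < N → topRuns N (std τ) ≡ topRuns N τ
topRuns-std N [] _ _ = refl
topRuns-std N τ@(_ ∷ _) below-N len<N = cong suc (begin
  dirChanges (N ∷ map (rank τ) τ)                ≡⟨ cong (dirChanges ∘ (N ∷_)) (sym (snds-graph (rank τ) τ)) ⟩
  dirChanges (snds ((N , N) ∷ graph (rank τ) τ)) ≡⟨ sym (dirChanges-sameOrder _ same) ⟩
  dirChanges (fsts ((N , N) ∷ graph (rank τ) τ)) ≡⟨ cong (dirChanges ∘ (N ∷_)) (fsts-graph (rank τ) τ) ⟩
  dirChanges (N ∷ τ)                             ∎)
  where
  open ≡-Reasoning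
  N-above : ∀ {a} → a ∈ τ → SameOrder (N , N) (a , rank τ a)
  N-above a∈ = let a<N = All.lookup below-N a∈ ; r<N = ≤-<-trans (below-<-length a∈) len<N in
    trans (<ᵇ-false (<⇒≯ a<N)) (sym (<ᵇ-false (<⇒≯ r<N))) , trans (<ᵇ-true a<N) (sym (<ᵇ-true r<N))
  same : Adjacent SameOrder ((N , N) ∷ graph (rank τ) τ)
  same = Adjacent-graph SameOrder-refl (λ {p} {q} → SameOrder-sym {p} {q}) (N , N) (rank τ) τ rank-sameOrder N-above

-- Complementation a ↦ m + 1 - a on permutations of [m]: an involution that
-- reverses all comparisons.
compl : ℕ → ℕ → ℕ
compl m a = suc m ∸ a

complement : ℕ → List ℕ → List ℕ
complement m = map (compl m)

compl-inRange : ∀ {m a} → InRange m a → InRange m (compl m a)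
compl-inRange {m} {suc a} (_ , a≤m) = m<n⇒0<n∸m (s≤s a≤m) , m∸n≤m m a

compl-involutive : ∀ {m a} → InRange m a → compl m (compl m a) ≡ a
compl-involutive (_ , a≤m) = m∸[m∸n]≡n (m≤n⇒m≤1+n a≤m)

complement-involutive : ∀ {m w} → All (InRange m) w → complement m (complement m w) ≡ w
complement-involutive [] = refl
complement-involutive (a∈ ∷ w∈) = cong₂ _∷_ (compl-involutive a∈) (complement-involutive w∈)

complement-isPerm : ∀ {m w} → IsPerm m w → IsPerm m (complement m w)
complement-isPerm {m} {w} (uniq , len , inRange) =
  Unique.map⁻ (subst Unique (sym (complement-involutive inRange)) uniq) ,
  trans (length-map (compl m) w) len ,
  All.map⁺ (All.map compl-inRange inRange)

-- complementation permutes 𝔖 m, so sums over 𝔖 m are invariant under it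
sumOf-complement : ∀ m (f : List ℕ → ℕ) → sumOf (𝔖 m) (f ∘ complement m) ≡ sumOf (𝔖 m) f
sumOf-complement m f = trans (sym (sumOf-map (complement m) (𝔖 m) f)) (sumOf-↭ f complement↭)
  where
  twice : map (complement m) (map (complement m) (𝔖 m)) ≡ 𝔖 m
  twice = trans (sym (map-∘ (𝔖 m)))
    (trans (map-cong-local {g = id} (All.tabulate (complement-involutive ∘ 𝔖-inRange))) (map-id (𝔖 m)))
  to : ∀ {x} → x ∈ map (complement m) (𝔖 m) → x ∈ 𝔖 m
  to x∈ with ∈-map⁻ (complement m) x∈
  ... | y , y∈ , refl = 𝔖-∈⁺ m (complement-isPerm (𝔖-∈⁻ m y∈))
  from : ∀ {x} → x ∈ 𝔖 m → x ∈ map (complement m) (𝔖 m)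
  from {x} x∈ = subst (_∈ map (complement m) (𝔖 m)) (complement-involutive (𝔖-inRange x∈))
    (∈-map⁺ (complement m) (𝔖-∈⁺ m (complement-isPerm (𝔖-∈⁻ m x∈))))
  complement↭ : map (complement m) (𝔖 m) ↭ 𝔖 m
  complement↭ = ∼bag⇒↭ (unique∧set⇒bag (Unique.map⁻ (subst Unique (sym twice) (𝔖-unique m))) (𝔖-unique m) (mk⇔ to from))

compl-<ᵇ : ∀ {m a b} → InRange m a → InRange m b → (a <ᵇ b) ≡ (compl m b <ᵇ compl m a)
compl-<ᵇ {m} {a} {b} (_ , a≤m) (_ , b≤m) with a <? b
... | yes a<b = trans (<ᵇ-true a<b) (sym (<ᵇ-true (∸-monoʳ-< a<b (m≤n⇒m≤1+n b≤m))))
... | no a≮b = trans (<ᵇ-false a≮b) (sym (<ᵇ-false (λ r → <⇒≱ r (∸-monoʳ-≤ (suc m) (≮⇒≥ a≮b)))))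

compl-oppositeOrder : ∀ {m w} → All (InRange m) w → ∀ {a b} → a ∈ w → b ∈ w →
  OppositeOrder (a , compl m a) (b , compl m b)
compl-oppositeOrder inRange a∈ b∈ =
  compl-<ᵇ (All.lookup inRange a∈) (All.lookup inRange b∈) , compl-<ᵇ (All.lookup inRange b∈) (All.lookup inRange a∈)

-- number of alternating runs of the word 0 α, with the empty word counted as
-- having 0 runs; this is the statistic whose generating polynomial is M_k
zeroRuns : List ℕ → ℕ
zeroRuns [] = 0
zeroRuns (a ∷ α) = altRuns (0 ∷ a ∷ α)

-- complementation turns a maximal first letter into a minimal one
topRuns-complement : ∀ N m β → m < N → All (InRange m) β → topRuns N β ≡ zeroRuns (complement m β)
topRuns-complement N m [] _ _ = refl
topRuns-complement N m β@(_ ∷ _) m<N inRange = cong suc (begin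
  dirChanges (N ∷ β)                              ≡⟨ cong (dirChanges ∘ (N ∷_)) (sym (fsts-graph (compl m) β)) ⟩
  dirChanges (fsts ((N , 0) ∷ graph (compl m) β)) ≡⟨ dirChanges-oppositeOrder _ opposite ⟩
  dirChanges (snds ((N , 0) ∷ graph (compl m) β)) ≡⟨ cong (dirChanges ∘ (0 ∷_)) (snds-graph (compl m) β) ⟩
  dirChanges (0 ∷ complement m β)                 ∎)
  where
  open ≡-Reasoning
  N-above : ∀ {a} → a ∈ β → OppositeOrder (N , 0) (a , compl m a)
  N-above {a} a∈ with All.lookup inRange a∈
  ... | a-inRange@(_ , a≤m) with compl m a | proj₁ (compl-inRange a-inRange)
  ...   | suc _ | _ = <ᵇ-false (<⇒≯ (≤-<-trans a≤m m<N)) , <ᵇ-true (≤-<-trans a≤m m<N)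
  opposite : Adjacent OppositeOrder ((N , 0) ∷ graph (compl m) β)
  opposite = Adjacent-graph OppositeOrder-refl (λ {p} {q} → OppositeOrder-sym {p} {q}) (N , 0) (compl m) β
               (compl-oppositeOrder inRange) N-above

-- reversing all comparisons preserves the alternating runs
altRuns-complement : ∀ m π → All (InRange m) π → altRuns (complement m π) ≡ altRuns π
altRuns-complement m [] _ = refl
altRuns-complement m (a ∷ π) inRange@(_ ∷ π-inRange) = cong suc (begin
  dirChanges (compl m a ∷ complement m π)                ≡⟨ cong (dirChanges ∘ (compl m a ∷_)) (sym (snds-graph (compl m) π)) ⟩
  dirChanges (snds ((a , compl m a) ∷ graph (compl m) π)) ≡⟨ sym (dirChanges-oppositeOrder _ opposite) ⟩
  dirChanges (fsts ((a , compl m a) ∷ graph (compl m) π)) ≡⟨ cong (dirChanges ∘ (a ∷_)) (fsts-graph (compl m) π) ⟩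
  dirChanges (a ∷ π)                                     ∎)
  where
  open ≡-Reasoning
  opposite : Adjacent OppositeOrder ((a , compl m a) ∷ graph (compl m) π)
  opposite = Adjacent-graph OppositeOrder-refl (λ {p} {q} → OppositeOrder-sym {p} {q}) (a , compl m a) (compl m) π
               (compl-oppositeOrder π-inRange) (λ b∈ → compl-oppositeOrder inRange (here refl) (there b∈))

bit≤1 : ∀ b → bit b ≤ 1
bit≤1 true = ≤-refl
bit≤1 false = z≤n

dirChanges-bound : ∀ w → dirChanges w ≤ length w ∸ 2
dirChanges-bound [] = z≤n
dirChanges-bound (a ∷ []) = z≤n
dirChanges-bound (a ∷ b ∷ []) = z≤n
dirChanges-bound (a ∷ b ∷ c ∷ w) = +-mono-≤ (bit≤1 (changesDir a b c)) (dirChanges-bound (b ∷ c ∷ w))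

-- a peak at b (a < b > c) excludes a peak at c
interiorPeaks-after-peak : ∀ b c w → (c <ᵇ b) ≡ true → interiorPeaks (b ∷ c ∷ w) ≡ interiorPeaks (c ∷ w)
interiorPeaks-after-peak b c [] _ = refl
interiorPeaks-after-peak b c (d ∷ w) c<b with b <ᵇ c in b<c
... | false = refl
... | true = ⊥-elim (<-asym (<ᵇ⇒< b c (subst T (sym b<c) tt)) (<ᵇ⇒< c b (subst T (sym c<b) tt)))

interiorPeaks-bound : ∀ x w → 2 * interiorPeaks (x ∷ w) ≤ length w
interiorPeaks-bound x [] = z≤n
interiorPeaks-bound x (y ∷ []) = z≤n
interiorPeaks-bound x (y ∷ z ∷ w) = step (interiorPeaks-bound y (z ∷ w)) (interiorPeaks-bound z w)
  where
  step : 2 * interiorPeaks (y ∷ z ∷ w) ≤ length (z ∷ w) → 2 * interiorPeaks (z ∷ w) ≤ length w →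
         2 * interiorPeaks (x ∷ y ∷ z ∷ w) ≤ length (y ∷ z ∷ w)
  step from-y from-z with (x <ᵇ y) ∧ (z <ᵇ y) in peak
  ... | false = m≤n⇒m≤1+n from-y
  ... | true rewrite interiorPeaks-after-peak y z w (∧-conicalʳ (x <ᵇ y) (z <ᵇ y) peak) =
    subst (_≤ suc (suc (length w))) (sym (*-distribˡ-+ 2 1 (interiorPeaks (z ∷ w)))) (s≤s (s≤s from-z))

leftPeaks-bound : ∀ π → leftPeaks π ≤ length π / 2
leftPeaks-bound π = subst (_≤ length π / 2) (m*n/n≡m (leftPeaks π) 2)
  (/-monoˡ-≤ 2 (subst (_≤ length π) (*-comm 2 (leftPeaks π)) (interiorPeaks-bound 0 π)))

Mpoly-genPoly : ∀ k → IsGenPoly (Mpoly k) (𝔖 k) zeroRuns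
Mpoly-genPoly zero zero = sym (trans (+-identityʳ _) (δ-refl 0))
Mpoly-genPoly zero (suc e) = sym (trans (+-identityʳ _) (δ-no (λ ())))
Mpoly-genPoly (suc k) e with e ≤? suc k
... | yes _ = begin
  M (suc k) e                                        ≡⟨ count≡sumOfδ (λ π → altRuns (0 ∷ π)) e (perms (suc k)) ⟩
  sumOf (perms (suc k)) (λ π → δ (altRuns (0 ∷ π)) e) ≡⟨ sumOf-cong (perms (suc k)) (λ π∈ → cong (λ r → δ r e) (nonEmpty (perms-∈⁻ (suc k) π∈))) ⟩
  sumOf (perms (suc k)) (λ π → δ (zeroRuns π) e)     ≡⟨ sumOf-perms (suc k) _ ⟩
  sumOf (𝔖 (suc k)) (λ π → δ (zeroRuns π) e)         ∎
  where
  open ≡-Reasoning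
  nonEmpty : ∀ {π} → IsPerm (suc k) π → altRuns (0 ∷ π) ≡ zeroRuns π
  nonEmpty {_ ∷ _} _ = refl
... | no e≰k+1 = sym (sumOf-zero (𝔖 (suc k)) (λ {α} α∈ → δ-no (λ zeroRuns≡e → e≰k+1
  (subst (_≤ suc k) zeroRuns≡e (subst (zeroRuns α ≤_) (𝔖-length α∈) (zeroRuns-bound α))))))
  where
  zeroRuns-bound : ∀ α → zeroRuns α ≤ length α
  zeroRuns-bound [] = z≤n
  zeroRuns-bound (a ∷ α) = s≤s (dirChanges-bound (0 ∷ a ∷ α))

-- P_n has degree at most n / 2 since left peaks are never adjacent
Ppoly-genPoly : ∀ n → IsGenPoly (Ppoly n) (𝔖 n) leftPeaks
Ppoly-genPoly n e with e ≤? n / 2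
... | yes _ = trans (count≡sumOfδ leftPeaks e (perms n)) (sumOf-perms n _)
... | no e≰n/2 = sym (sumOf-zero (𝔖 n) (λ {β} β∈ → δ-no (λ leftPeaks≡e → e≰n/2
  (subst (_≤ n / 2) leftPeaks≡e (subst (λ l → leftPeaks β ≤ l / 2) (𝔖-length {n} β∈) (leftPeaks-bound β))))))

-- for m ≥ 2 every permutation has between 1 and m - 1 alternating runs
Rpoly-genPoly : ∀ m → 2 ≤ m → IsGenPoly (Rpoly m) (𝔖 m) altRuns
Rpoly-genPoly m 2≤m e with (1 ≤? e) ×-dec (suc e ≤? m)
... | yes _ = trans (count≡sumOfδ altRuns e (perms m)) (sumOf-perms m _)
... | no out-of-range = sym (sumOf-zero (𝔖 m) (λ {π} π∈ → δ-no (λ altRuns≡e → out-of-range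
  (subst (1 ≤_) altRuns≡e (s≤s z≤n) , subst (λ r → suc r ≤ m) altRuns≡e (altRuns<length π (𝔖-length {m} π∈))))))
  where
  altRuns<length : ∀ π → length π ≡ m → suc (altRuns π) ≤ m
  altRuns<length π refl = subst (suc (altRuns π) ≤_) (m+[n∸m]≡n 2≤m) (s≤s (s≤s (dirChanges-bound π)))

startsDown : ℕ → List ℕ → ℕ
startsDown x [] = 0
startsDown x (y ∷ _) = bit (y <ᵇ x)

dirChanges-append-top : ∀ N x w → All (_< N) (x ∷ w) → Unique (x ∷ w) →
  dirChanges (x ∷ w ++ N ∷ []) ≡ 2 * interiorPeaks (x ∷ w) + startsDown x w
dirChanges-append-top N x [] _ _ = refl
dirChanges-append-top N x (y ∷ []) (_ ∷ y<N ∷ _) ((x≢y ∷ _) ∷ _) with <-cmp x y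
... | tri< x<y _ _ rewrite <ᵇ-true x<y | <ᵇ-false (<⇒≯ x<y) | <ᵇ-false (<⇒≯ y<N) = refl
... | tri≈ _ x≡y _ = ⊥-elim (x≢y x≡y)
... | tri> _ _ y<x rewrite <ᵇ-false (<⇒≯ y<x) | <ᵇ-true y<x | <ᵇ-true y<N = refl
dirChanges-append-top N x (y ∷ z ∷ w) (_ ∷ below-N) ((x≢y ∷ _) ∷ uniq@((y≢z ∷ _) ∷ _))
  with dirChanges-append-top N y (z ∷ w) below-N uniq | <-cmp x y | <-cmp z y
... | _ | tri≈ _ x≡y _ | _ = ⊥-elim (x≢y x≡y)
... | _ | _ | tri≈ _ z≡y _ = ⊥-elim (y≢z (sym z≡y))
... | ih | tri< x<y _ _ | tri< z<y _ _ rewrite <ᵇ-true x<y | <ᵇ-false (<⇒≯ x<y) | <ᵇ-true z<y | ih =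
  arith (interiorPeaks (y ∷ z ∷ w))
  where
  arith : ∀ p → 1 + (2 * p + 1) ≡ 2 * (1 + p) + 0
  arith = solve-∀
... | ih | tri< x<y _ _ | tri> _ _ y<z rewrite <ᵇ-true x<y | <ᵇ-false (<⇒≯ x<y) | <ᵇ-false (<⇒≯ y<z) | ih =
  arith (interiorPeaks (y ∷ z ∷ w))
  where
  arith : ∀ p → 0 + (2 * p + 0) ≡ 2 * (0 + p) + 0
  arith = solve-∀
... | ih | tri> _ _ y<x | tri< z<y _ _ rewrite <ᵇ-true y<x | <ᵇ-false (<⇒≯ y<x) | <ᵇ-true z<y | <ᵇ-false (<⇒≯ z<y) | ih =
  arith (interiorPeaks (y ∷ z ∷ w))
  where
  arith : ∀ p → 0 + (2 * p + 1) ≡ 2 * (0 + p) + 1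
  arith = solve-∀
... | ih | tri> _ _ y<x | tri> _ _ y<z rewrite <ᵇ-true y<x | <ᵇ-false (<⇒≯ y<x) | <ᵇ-true y<z | <ᵇ-false (<⇒≯ y<z) | ih =
  arith (interiorPeaks (y ∷ z ∷ w))
  where
  arith : ∀ p → 1 + (2 * p + 0) ≡ 2 * (0 + p) + 1
  arith = solve-∀

-- N is a peak of x σ N t v, so the direction changes split there
dirChanges-split-at-top : ∀ N x σ t v → All (_< N) (x ∷ σ) → t < N →
  dirChanges (x ∷ σ ++ N ∷ t ∷ v) ≡ dirChanges (x ∷ σ ++ N ∷ []) + suc (dirChanges (N ∷ t ∷ v))
dirChanges-split-at-top N x [] t v (x<N ∷ _) t<N rewrite <ᵇ-true x<N | <ᵇ-true t<N = refl
dirChanges-split-at-top N x (y ∷ []) t v (_ ∷ y<N ∷ _) t<N rewrite <ᵇ-true y<N | <ᵇ-true t<N =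
  cong (_+ suc (dirChanges (N ∷ t ∷ v))) (sym (+-identityʳ _))
dirChanges-split-at-top N x (y ∷ z ∷ σ) t v (_ ∷ below-N) t<N
  rewrite dirChanges-split-at-top N y (z ∷ σ) t v below-N t<N =
  sym (+-assoc (bit (changesDir x y z)) (dirChanges (y ∷ z ∷ σ ++ N ∷ [])) _)

altRuns-insert-top : ∀ N σ τ → All (_< N) σ → All (_< N) τ → 0 < N → Unique (0 ∷ σ) →
  altRuns (0 ∷ σ ++ N ∷ τ) ≡ suc (2 * leftPeaks σ + topRuns N τ)
altRuns-insert-top N σ [] σ<N _ 0<N uniq =
  cong suc (trans (dirChanges-append-top N 0 σ (0<N ∷ σ<N) uniq) (cong (2 * leftPeaks σ +_) (startsUp σ)))
  where
  startsUp : ∀ σ → startsDown 0 σ ≡ 0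
  startsUp [] = refl
  startsUp (_ ∷ _) = refl
altRuns-insert-top N σ (t ∷ v) σ<N (t<N ∷ _) 0<N uniq = cong suc (begin
  dirChanges (0 ∷ σ ++ N ∷ t ∷ v)                              ≡⟨ dirChanges-split-at-top N 0 σ t v (0<N ∷ σ<N) t<N ⟩
  dirChanges (0 ∷ σ ++ N ∷ []) + suc (dirChanges (N ∷ t ∷ v))   ≡⟨ cong (_+ suc (dirChanges (N ∷ t ∷ v))) (dirChanges-append-top N 0 σ (0<N ∷ σ<N) uniq) ⟩
  2 * leftPeaks σ + startsDown 0 σ + suc (dirChanges (N ∷ t ∷ v)) ≡⟨ cong (λ e → 2 * leftPeaks σ + e + suc (dirChanges (N ∷ t ∷ v))) (startsUp σ) ⟩
  2 * leftPeaks σ + 0 + suc (dirChanges (N ∷ t ∷ v))           ≡⟨ cong (_+ suc (dirChanges (N ∷ t ∷ v))) (+-identityʳ _) ⟩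
  2 * leftPeaks σ + suc (dirChanges (N ∷ t ∷ v))               ∎)
  where
  open ≡-Reasoning
  startsUp : ∀ σ → startsDown 0 σ ≡ 0
  startsUp [] = refl
  startsUp (_ ∷ _) = refl

Split : Set
Split = List ℕ × List ℕ

consˡ : ℕ → Split → Split
consˡ a p = (a ∷ proj₁ p) , proj₂ p

splittings : List ℕ → List Split
splittings [] = ([] , []) ∷ []
splittings (a ∷ w) = ([] , a ∷ w) ∷ map (consˡ a) (splittings w)

glue : ℕ → Split → List ℕ
glue M p = proj₁ p ++ M ∷ proj₂ p

splittings-∈ : ∀ {ρ p} → p ∈ splittings ρ → proj₁ p ++ proj₂ p ≡ ρ
splittings-∈ {[]} (here refl) = refl
splittings-∈ {a ∷ w} (here refl) = refl
splittings-∈ {a ∷ w} (there p∈) with ∈-map⁻ (consˡ a) p∈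
... | q , q∈ , refl = cong (a ∷_) (splittings-∈ q∈)

sumOf-insertions : ∀ M ρ (f : List ℕ → ℕ) → sumOf (insertions M ρ) f ≡ sumOf (splittings ρ) (f ∘ glue M)
sumOf-insertions M ρ f = trans (cong (λ L → sumOf L f) (insertions≡glue ρ)) (sumOf-map (glue M) (splittings ρ) f)
  where
  insertions≡glue : ∀ ρ → insertions M ρ ≡ map (glue M) (splittings ρ)
  insertions≡glue [] = refl
  insertions≡glue (a ∷ w) = cong ((M ∷ a ∷ w) ∷_)
    (trans (cong (map (a ∷_)) (insertions≡glue w)) (trans (sym (map-∘ (splittings w))) (map-∘ (splittings w))))

sumOf-splittings-mid : ∀ γ x δ (H : Split → ℕ) →
  sumOf (splittings (γ ++ x ∷ δ)) H
  ≡ sumOf (splittings γ) (λ p → H (proj₁ p , proj₂ p ++ x ∷ δ)) + sumOf (splittings δ) (λ q → H (γ ++ x ∷ proj₁ q , proj₂ q))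
sumOf-splittings-mid [] x δ H =
  trans (cong (H ([] , x ∷ δ) +_) (sumOf-map (consˡ x) (splittings δ) H)) (cong (_+ sumOf (splittings δ) (λ q → H (x ∷ proj₁ q , proj₂ q))) (sym (+-identityʳ (H ([] , x ∷ δ)))))
sumOf-splittings-mid (a ∷ γ) x δ H = begin
  H ([] , a ∷ γ ++ x ∷ δ) + sumOf (map (consˡ a) (splittings (γ ++ x ∷ δ))) H
    ≡⟨ cong (H ([] , a ∷ γ ++ x ∷ δ) +_) (trans (sumOf-map (consˡ a) (splittings (γ ++ x ∷ δ)) H) (sumOf-splittings-mid γ x δ (H ∘ consˡ a))) ⟩
  H ([] , a ∷ γ ++ x ∷ δ) + (sumOf (splittings γ) (λ p → H (consˡ a p .proj₁ , proj₂ p ++ x ∷ δ)) + right)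
    ≡⟨ sym (+-assoc (H ([] , a ∷ γ ++ x ∷ δ)) _ right) ⟩
  H ([] , a ∷ γ ++ x ∷ δ) + sumOf (splittings γ) (λ p → H (consˡ a p .proj₁ , proj₂ p ++ x ∷ δ)) + right
    ≡⟨ cong (λ e → H ([] , a ∷ γ ++ x ∷ δ) + e + right) (sym (sumOf-map (consˡ a) (splittings γ) _)) ⟩
  H ([] , a ∷ γ ++ x ∷ δ) + sumOf (map (consˡ a) (splittings γ)) (λ p → H (proj₁ p , proj₂ p ++ x ∷ δ)) + right ∎
  where
  open ≡-Reasoning
  right : ℕ
  right = sumOf (splittings δ) (λ q → H (a ∷ γ ++ x ∷ proj₁ q , proj₂ q))

splittings-assoc : ∀ ρ (F : List ℕ → List ℕ → List ℕ → ℕ) →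
  sumOf (splittings ρ) (λ p → sumOf (splittings (proj₁ p)) (λ q → F (proj₁ q) (proj₂ q) (proj₂ p)))
  ≡ sumOf (splittings ρ) (λ p → sumOf (splittings (proj₂ p)) (λ q → F (proj₁ p) (proj₁ q) (proj₂ q)))
splittings-assoc [] F = refl
splittings-assoc (a ∷ w) F = begin
  (F [] [] (a ∷ w) + 0) + sumOf (map (consˡ a) (splittings w)) (λ p → sumOf (splittings (proj₁ p)) (λ q → F (proj₁ q) (proj₂ q) (proj₂ p)))
    ≡⟨ cong ((F [] [] (a ∷ w) + 0) +_) (trans (sumOf-map (consˡ a) (splittings w) _)
         (sumOf-ext (splittings w) (λ p → cong (F [] (a ∷ proj₁ p) (proj₂ p) +_) (sumOf-map (consˡ a) (splittings (proj₁ p)) _)))) ⟩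
  (F [] [] (a ∷ w) + 0) + sumOf (splittings w) (λ p → F [] (a ∷ proj₁ p) (proj₂ p) + sumOf (splittings (proj₁ p)) (λ q → F (a ∷ proj₁ q) (proj₂ q) (proj₂ p)))
    ≡⟨ cong ((F [] [] (a ∷ w) + 0) +_) (sumOf-+ (splittings w) _ _) ⟩
  (F [] [] (a ∷ w) + 0) + (firstEmpty + sumOf (splittings w) (λ p → sumOf (splittings (proj₁ p)) (λ q → F (a ∷ proj₁ q) (proj₂ q) (proj₂ p))))
    ≡⟨ cong (λ e → (F [] [] (a ∷ w) + 0) + (firstEmpty + e)) (splittings-assoc w (λ x y z → F (a ∷ x) y z)) ⟩
  (F [] [] (a ∷ w) + 0) + (firstEmpty + sumOf (splittings w) (λ p → sumOf (splittings (proj₂ p)) (λ q → F (a ∷ proj₁ p) (proj₁ q) (proj₂ q))))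
    ≡⟨ regroup (F [] [] (a ∷ w)) firstEmpty _ ⟩
  (F [] [] (a ∷ w) + firstEmpty) + sumOf (splittings w) (λ p → sumOf (splittings (proj₂ p)) (λ q → F (a ∷ proj₁ p) (proj₁ q) (proj₂ q)))
    ≡⟨ cong₂ (λ e e′ → (F [] [] (a ∷ w) + e) + e′) (sym (sumOf-map (consˡ a) (splittings w) _)) (sym (sumOf-map (consˡ a) (splittings w) _)) ⟩
  (F [] [] (a ∷ w) + sumOf (map (consˡ a) (splittings w)) (λ q → F [] (proj₁ q) (proj₂ q)))
    + sumOf (map (consˡ a) (splittings w)) (λ p → sumOf (splittings (proj₂ p)) (λ q → F (proj₁ p) (proj₁ q) (proj₂ q))) ∎
  where
  open ≡-Reasoning
  firstEmpty : ℕ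
  firstEmpty = sumOf (splittings w) (λ p → F [] (a ∷ proj₁ p) (proj₂ p))
  regroup : ∀ x y z → (x + 0) + (y + z) ≡ (x + y) + z
  regroup = solve-∀

sumOf-splittings-map : ∀ (f : ℕ → ℕ) w (H : Split → ℕ) →
  sumOf (splittings (map f w)) H ≡ sumOf (splittings w) (λ p → H (map f (proj₁ p) , map f (proj₂ p)))
sumOf-splittings-map f [] H = refl
sumOf-splittings-map f (a ∷ w) H = cong (H ([] , f a ∷ map f w) +_) (begin
  sumOf (map (consˡ (f a)) (splittings (map f w))) H                 ≡⟨ sumOf-map (consˡ (f a)) (splittings (map f w)) H ⟩
  sumOf (splittings (map f w)) (H ∘ consˡ (f a))                     ≡⟨ sumOf-splittings-map f w (H ∘ consˡ (f a)) ⟩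
  sumOf (splittings w) (λ p → H (f a ∷ map f (proj₁ p) , map f (proj₂ p))) ≡⟨ sym (sumOf-map (consˡ a) (splittings w) _) ⟩
  sumOf (map (consˡ a) (splittings w)) (λ p → H (map f (proj₁ p) , map f (proj₂ p))) ∎)
  where open ≡-Reasoning

below-mid : ∀ a σ M τ → below a (σ ++ M ∷ τ) ≡ bit (M <ᵇ a) + below a (σ ++ τ)
below-mid a [] M τ = refl
below-mid a (b ∷ σ) M τ = trans (cong (bit (b <ᵇ a) +_) (below-mid a σ M τ)) (swap (bit (b <ᵇ a)) (bit (M <ᵇ a)) _)
  where
  swap : ∀ x y z → x + (y + z) ≡ y + (x + z)
  swap = solve-∀

below-all : ∀ {M w} → All (_< M) w → below M w ≡ length w
below-all [] = refl
below-all (a<M ∷ w<M) rewrite <ᵇ-true a<M = cong suc (below-all w<M)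

std-glue-top : ∀ M σ τ → All (_< M) (σ ++ τ) →
  std (σ ++ M ∷ τ) ≡ glue (suc (length (σ ++ τ))) (map (rank (σ ++ τ)) σ , map (rank (σ ++ τ)) τ)
std-glue-top M σ τ below-M = begin
  map rank′ (σ ++ M ∷ τ)                                                ≡⟨ map-++ rank′ σ (M ∷ τ) ⟩
  map rank′ σ ++ rank′ M ∷ map rank′ τ                                  ≡⟨ cong₂ (λ u v → u ++ v ∷ map rank′ τ) (map-cong-local (All.tabulate (old ∘ ∈-++⁺ˡ))) top ⟩
  map (rank (σ ++ τ)) σ ++ suc (length (σ ++ τ)) ∷ map rank′ τ          ≡⟨ cong (λ u → map (rank (σ ++ τ)) σ ++ suc (length (σ ++ τ)) ∷ u) (map-cong-local (All.tabulate (old ∘ ∈-++⁺ʳ σ))) ⟩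
  map (rank (σ ++ τ)) σ ++ suc (length (σ ++ τ)) ∷ map (rank (σ ++ τ)) τ ∎
  where
  open ≡-Reasoning
  rank′ : ℕ → ℕ
  rank′ = rank (σ ++ M ∷ τ)
  old : ∀ {a} → a ∈ σ ++ τ → rank′ a ≡ rank (σ ++ τ) a
  old {a} a∈ rewrite below-mid a σ M τ | <ᵇ-false (<⇒≯ (All.lookup below-M a∈)) = refl
  top : rank′ M ≡ suc (length (σ ++ τ))
  top rewrite below-mid M σ M τ | <ᵇ-false (n≮n M) = cong suc (below-all below-M)

sumOf-insertions-std : ∀ M τ (K : List ℕ → ℕ) → All (_< M) τ →
  sumOf (insertions M τ) (K ∘ std) ≡ sumOf (insertions (suc (length τ)) (std τ)) K
sumOf-insertions-std M τ K below-M = begin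
  sumOf (insertions M τ) (K ∘ std)                          ≡⟨ sumOf-insertions M τ _ ⟩
  sumOf (splittings τ) (K ∘ std ∘ glue M)                   ≡⟨ sumOf-cong (splittings τ) (cong K ∘ glued) ⟩
  sumOf (splittings τ) (λ p → K (glue (suc (length τ)) (map (rank τ) (proj₁ p) , map (rank τ) (proj₂ p))))
                                                            ≡⟨ sym (sumOf-splittings-map (rank τ) τ _) ⟩
  sumOf (splittings (std τ)) (K ∘ glue (suc (length τ)))    ≡⟨ sym (sumOf-insertions _ (std τ) K) ⟩
  sumOf (insertions (suc (length τ)) (std τ)) K             ∎
  where
  open ≡-Reasoning
  glued : ∀ {p} → p ∈ splittings τ →
    std (glue M p) ≡ glue (suc (length τ)) (map (rank τ) (proj₁ p) , map (rank τ) (proj₂ p))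
  glued {σ′ , τ′} p∈ with splittings-∈ p∈
  ... | refl = std-glue-top M σ′ τ′ below-M

-- The binomial splitting lemma.  Splitting every permutation of [n] into a
-- prefix and a suffix and standardizing both parts produces every pair
-- (α , β) ∈ 𝔖 j × 𝔖 (n - j) exactly C(n,j) times.
pairSum : (List ℕ → List ℕ → ℕ) → ℕ → ℕ → ℕ
pairSum K a b = sumOf (𝔖 a) (λ α → sumOf (𝔖 b) (K α))

H[_] : (List ℕ → List ℕ → ℕ) → Split → ℕ
H[ K ] p = K (std (proj₁ p)) (std (proj₂ p))

splitSum : (List ℕ → List ℕ → ℕ) → ℕ → ℕ
splitSum K n = sumOf (𝔖 n) (λ ρ → sumOf (splittings ρ) H[ K ])

extendEither : (List ℕ → List ℕ → ℕ) → List ℕ → List ℕ → ℕ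
extendEither K α β = sumOf (insertions (suc (length β)) β) (K α) + sumOf (insertions (suc (length α)) α) (λ α′ → K α′ β)

sumOf-𝔖-suc : ∀ m (f : List ℕ → ℕ) →
  sumOf (𝔖 m) (λ β → sumOf (insertions (suc (length β)) β) f) ≡ sumOf (𝔖 (suc m)) f
sumOf-𝔖-suc m f = trans (sumOf-cong (𝔖 m) (λ {β} β∈ → cong (λ l → sumOf (insertions (suc l) β) f) (𝔖-length {m} β∈)))
                        (sym (sumOf-concatMap (insertions (suc m)) (𝔖 m) f))

pairSum-extendEither : ∀ K a b → pairSum (extendEither K) a b ≡ pairSum K a (suc b) + pairSum K (suc a) b
pairSum-extendEither K a b = begin
  sumOf (𝔖 a) (λ α → sumOf (𝔖 b) (extendEither K α))
    ≡⟨ trans (sumOf-ext (𝔖 a) (λ α → sumOf-+ (𝔖 b) _ _)) (sumOf-+ (𝔖 a) _ _) ⟩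
  sumOf (𝔖 a) (λ α → sumOf (𝔖 b) (λ β → sumOf (insertions (suc (length β)) β) (K α)))
    + sumOf (𝔖 a) (λ α → sumOf (𝔖 b) (λ β → sumOf (insertions (suc (length α)) α) (λ α′ → K α′ β)))
    ≡⟨ cong₂ _+_ (sumOf-ext (𝔖 a) (λ α → sumOf-𝔖-suc b (K α)))
         (trans (sumOf-ext (𝔖 a) (λ α → sumOf-swap (𝔖 b) (insertions (suc (length α)) α) (λ β α′ → K α′ β)))
                (sumOf-𝔖-suc a (λ α′ → sumOf (𝔖 b) (K α′)))) ⟩
  pairSum K a (suc b) + pairSum K (suc a) b ∎
  where open ≡-Reasoning

sumOf-splittings-glue-top : ∀ N ρ (K : List ℕ → List ℕ → ℕ) → All (_< N) ρ →
  sumOf (splittings ρ) (λ q → sumOf (splittings (glue N q)) H[ K ])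
  ≡ sumOf (splittings ρ) H[ extendEither K ]
sumOf-splittings-glue-top N ρ K below-N = begin
  sumOf (splittings ρ) (λ q → sumOf (splittings (glue N q)) H[ K ])
    ≡⟨ sumOf-ext (splittings ρ) (λ q → sumOf-splittings-mid (proj₁ q) N (proj₂ q) H[ K ]) ⟩
  sumOf (splittings ρ) (λ q → sumOf (splittings (proj₁ q)) (λ p → H[ K ] (proj₁ p , proj₂ p ++ N ∷ proj₂ q))
                            + sumOf (splittings (proj₂ q)) (λ p → H[ K ] (proj₁ q ++ N ∷ proj₁ p , proj₂ p)))
    ≡⟨ sumOf-+ (splittings ρ) _ _ ⟩
  sumOf (splittings ρ) (λ q → sumOf (splittings (proj₁ q)) (λ p → H[ K ] (proj₁ p , proj₂ p ++ N ∷ proj₂ q)))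
    + sumOf (splittings ρ) (λ q → sumOf (splittings (proj₂ q)) (λ p → H[ K ] (proj₁ q ++ N ∷ proj₁ p , proj₂ p)))
    ≡⟨ cong₂ _+_ (splittings-assoc ρ (λ x y z → H[ K ] (x , y ++ N ∷ z)))
                 (sym (splittings-assoc ρ (λ x y z → H[ K ] (x ++ N ∷ y , z)))) ⟩
  sumOf (splittings ρ) (λ q → sumOf (splittings (proj₂ q)) (λ p → H[ K ] (proj₁ q , glue N p)))
    + sumOf (splittings ρ) (λ q → sumOf (splittings (proj₁ q)) (λ p → H[ K ] (glue N p , proj₂ q)))
    ≡⟨ sym (sumOf-+ (splittings ρ) _ _) ⟩
  sumOf (splittings ρ) (λ q → sumOf (splittings (proj₂ q)) (λ p → H[ K ] (proj₁ q , glue N p))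
                            + sumOf (splittings (proj₁ q)) (λ p → H[ K ] (glue N p , proj₂ q)))
    ≡⟨ sumOf-cong (splittings ρ) extend ⟩
  sumOf (splittings ρ) H[ extendEither K ] ∎
  where
  open ≡-Reasoning
  extend : ∀ {q} → q ∈ splittings ρ →
    sumOf (splittings (proj₂ q)) (λ p → H[ K ] (proj₁ q , glue N p)) + sumOf (splittings (proj₁ q)) (λ p → H[ K ] (glue N p , proj₂ q))
    ≡ H[ extendEither K ] q
  extend {σ , τ} q∈ = cong₂ _+_
    (trans (sym (sumOf-insertions N τ (K (std σ) ∘ std)))
      (trans (sumOf-insertions-std N τ (K (std σ)) τ<N) (cong (λ l → sumOf (insertions (suc l) (std τ)) (K (std σ))) (sym (length-map (rank τ) τ)))))
    (trans (sym (sumOf-insertions N σ (λ σ′ → K (std σ′) (std τ))))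
      (trans (sumOf-insertions-std N σ (λ α′ → K α′ (std τ)) σ<N) (cong (λ l → sumOf (insertions (suc l) (std σ)) (λ α′ → K α′ (std τ))) (sym (length-map (rank σ) σ)))))
    where
    στ<N : All (_< N) (σ ++ τ)
    στ<N = subst (All (_< N)) (sym (splittings-∈ q∈)) below-N
    σ<N : All (_< N) σ
    σ<N = All.++⁻ˡ σ στ<N
    τ<N : All (_< N) τ
    τ<N = All.++⁻ʳ σ στ<N

-- by induction on n, distributing the new letter n + 1 over the two parts
binomialSplitting : ∀ n (K : List ℕ → List ℕ → ℕ) →
  splitSum K n ≡ sumBelow (suc n) (λ j → (n C j) * pairSum K j (n ∸ j))
binomialSplitting zero K = arith (K [] [])
  where
  arith : ∀ x → x + 0 + 0 ≡ 0 + 1 * (x + 0 + 0)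
  arith = solve-∀
binomialSplitting (suc n) K = begin
  splitSum K (suc n)
    ≡⟨ sumOf-concatMap (insertions (suc n)) (𝔖 n) _ ⟩
  sumOf (𝔖 n) (λ ρ → sumOf (insertions (suc n) ρ) (λ ρ′ → sumOf (splittings ρ′) H[ K ]))
    ≡⟨ sumOf-ext (𝔖 n) (λ ρ → sumOf-insertions (suc n) ρ _) ⟩
  sumOf (𝔖 n) (λ ρ → sumOf (splittings ρ) (λ q → sumOf (splittings (glue (suc n) q)) H[ K ]))
    ≡⟨ sumOf-cong (𝔖 n) (λ ρ∈ → sumOf-splittings-glue-top (suc n) _ K (All.map (s≤s ∘ proj₂) (𝔖-inRange ρ∈))) ⟩
  splitSum (extendEither K) n
    ≡⟨ binomialSplitting n (extendEither K) ⟩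
  sumBelow (suc n) (λ j → (n C j) * pairSum (extendEither K) j (n ∸ j))
    ≡⟨ sumBelow-cong (suc n) (λ j _ → cong ((n C j) *_) (pairSum-extendEither K j (n ∸ j))) ⟩
  sumBelow (suc n) (λ j → (n C j) * (pairSum K j (suc (n ∸ j)) + pairSum K (suc j) (n ∸ j)))
    ≡⟨ sym (pascal (pairSum K) n) ⟩
  sumBelow (suc (suc n)) (λ j → (suc n C j) * pairSum K j (suc n ∸ j)) ∎
  where open ≡-Reasoning

zeroRuns-glue-top : ∀ n {ρ} → ρ ∈ 𝔖 n → ∀ {p} → p ∈ splittings ρ →
  zeroRuns (glue (suc n) p) ≡ suc (2 * leftPeaks (std (proj₁ p)) + topRuns (suc n) (std (proj₂ p)))
zeroRuns-glue-top n ρ∈ {σ , τ} p∈ with 𝔖-∈⁻ n ρ∈ | splittings-∈ p∈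
... | uniq , len , inRange | refl = begin
  zeroRuns (σ ++ suc n ∷ τ)                           ≡⟨ nonEmpty σ ⟩
  altRuns (0 ∷ σ ++ suc n ∷ τ)                        ≡⟨ altRuns-insert-top (suc n) σ τ σ<N τ<N (s≤s z≤n) uniq₀ ⟩
  suc (2 * leftPeaks σ + topRuns (suc n) τ)           ≡⟨ cong₂ (λ x y → suc (2 * x + y)) (sym (leftPeaks-std σ σ-positive)) (sym (topRuns-std (suc n) τ τ<N |τ|<N)) ⟩
  suc (2 * leftPeaks (std σ) + topRuns (suc n) (std τ)) ∎
  where
  open ≡-Reasoning
  nonEmpty : ∀ σ → zeroRuns (σ ++ suc n ∷ τ) ≡ altRuns (0 ∷ σ ++ suc n ∷ τ)
  nonEmpty [] = refl
  nonEmpty (_ ∷ _) = refl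
  στ<N : All (_< suc n) (σ ++ τ)
  στ<N = All.map (s≤s ∘ proj₂) inRange
  σ<N : All (_< suc n) σ
  σ<N = All.++⁻ˡ σ στ<N
  τ<N : All (_< suc n) τ
  τ<N = All.++⁻ʳ σ στ<N
  σ-positive : All (0 <_) σ
  σ-positive = All.map proj₁ (All.++⁻ˡ σ inRange)
  uniq₀ : Unique (0 ∷ σ)
  uniq₀ = All.map (λ 0<a 0≡a → <⇒≢ 0<a 0≡a) σ-positive ∷ Unique-prefix σ uniq
  |τ|<N : length τ < suc n
  |τ|<N = s≤s (subst (length τ ≤_) len (subst (length τ ≤_) (sym (length-++ σ)) (m≤n+m (length τ) (length σ))))

peaksAndTopRuns : ℕ → ℕ → List ℕ → List ℕ → ℕ
peaksAndTopRuns N d α β = δ (2 * leftPeaks α + topRuns N β) d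

Mpoly-splitSum : ∀ n d → Mpoly (suc n) (suc d) ≡ splitSum (peaksAndTopRuns (suc n) d) n
Mpoly-splitSum n d = begin
  Mpoly (suc n) (suc d)
    ≡⟨ Mpoly-genPoly (suc n) (suc d) ⟩
  sumOf (𝔖 (suc n)) (λ π → δ (zeroRuns π) (suc d))
    ≡⟨ sumOf-concatMap (insertions (suc n)) (𝔖 n) _ ⟩
  sumOf (𝔖 n) (λ ρ → sumOf (insertions (suc n) ρ) (λ π → δ (zeroRuns π) (suc d)))
    ≡⟨ sumOf-cong (𝔖 n) (λ {ρ} ρ∈ → trans (sumOf-insertions (suc n) ρ _) (sumOf-cong (splittings ρ) (λ p∈ →
         trans (cong (λ r → δ r (suc d)) (zeroRuns-glue-top n ρ∈ p∈)) (δ-suc _ d)))) ⟩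
  splitSum (peaksAndTopRuns (suc n) d) n ∎
  where open ≡-Reasoning

-- complementing β turns the weight into a coefficient of M_m(x) P_j(x²)
pairSum-peaksAndTopRuns : ∀ N j m d → m < N →
  pairSum (peaksAndTopRuns N d) j m ≡ (Mpoly m ⊛ atSquare (Ppoly j)) d
pairSum-peaksAndTopRuns N j m d m<N = begin
  sumOf (𝔖 j) (λ α → sumOf (𝔖 m) (λ β → δ (2 * leftPeaks α + topRuns N β) d))
    ≡⟨ sumOf-ext (𝔖 j) (λ α → sumOf-cong (𝔖 m) (λ β∈ →
         cong (λ r → δ (2 * leftPeaks α + r) d) (topRuns-complement N m _ m<N (𝔖-inRange β∈)))) ⟩
  sumOf (𝔖 j) (λ α → sumOf (𝔖 m) (λ β → δ (2 * leftPeaks α + zeroRuns (complement m β)) d))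
    ≡⟨ sumOf-ext (𝔖 j) (λ α → sumOf-complement m (λ β → δ (2 * leftPeaks α + zeroRuns β) d)) ⟩
  sumOf (𝔖 j) (λ α → sumOf (𝔖 m) (λ β → δ (2 * leftPeaks α + zeroRuns β) d))
    ≡⟨ sumOf-swap (𝔖 j) (𝔖 m) _ ⟩
  sumOf (𝔖 m) (λ β → sumOf (𝔖 j) (λ α → δ (2 * leftPeaks α + zeroRuns β) d))
    ≡⟨ sumOf-ext (𝔖 m) (λ β → sumOf-ext (𝔖 j) (λ α → cong (λ r → δ r d) (+-comm (2 * leftPeaks α) (zeroRuns β)))) ⟩
  sumOf (𝔖 m) (λ β → sumOf (𝔖 j) (λ α → δ (zeroRuns β + 2 * leftPeaks α) d))
    ≡⟨ sym (⊛-genPoly {L = 𝔖 m} {𝔖 j} {zeroRuns} {λ α → 2 * leftPeaks α} (Mpoly-genPoly m) (atSquare-genPoly {L = 𝔖 j} {leftPeaks} (Ppoly-genPoly j)) d) ⟩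
  (Mpoly m ⊛ atSquare (Ppoly j)) d ∎
  where open ≡-Reasoning

Mpoly-identity : ∀ n → Mpoly (suc n) ≈P X* (convSum n)
Mpoly-identity n zero = trans (Mpoly-genPoly (suc n) 0)
  (sumOf-zero (𝔖 (suc n)) (λ π∈ → δ-no (noZeroRuns (𝔖-length {suc n} π∈))))
  where
  noZeroRuns : ∀ {π} → length π ≡ suc n → ¬ zeroRuns π ≡ 0
  noZeroRuns {_ ∷ _} _ ()
Mpoly-identity n (suc d) = begin
  Mpoly (suc n) (suc d)                                                   ≡⟨ Mpoly-splitSum n d ⟩
  splitSum (peaksAndTopRuns (suc n) d) n                                  ≡⟨ binomialSplitting n _ ⟩
  sumBelow (suc n) (λ j → (n C j) * pairSum (peaksAndTopRuns (suc n) d) j (n ∸ j))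
    ≡⟨ sumBelow-cong (suc n) (λ j _ → cong ((n C j) *_) (pairSum-peaksAndTopRuns (suc n) j (n ∸ j) d (s≤s (m∸n≤m n j)))) ⟩
  sumBelow (suc n) (λ j → (n C j) * (Mpoly (n ∸ j) ⊛ atSquare (Ppoly j)) d) ≡⟨ sumBelow-binomial-reflect n (λ k j → (Mpoly k ⊛ atSquare (Ppoly j)) d) ⟩
  sumBelow (suc n) (λ k → (n C k) * (Mpoly k ⊛ atSquare (Ppoly (n ∸ k))) d) ≡⟨ sym (sumOf-upTo (suc n) _) ⟩
  convSum n d ∎
  where open ≡-Reasoning

-- The R identity.  For a permutation π of [m] (m ≥ 2), 0 π and 0 π^c have
-- altRuns(π) and altRuns(π) + 1 runs, in some order, according as π starts
-- with an ascent or a descent.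
-- the initial 0 adds a run exactly when the word starts with a descent
zeroRuns-start : ∀ a b w → 0 < a → zeroRuns (a ∷ b ∷ w) ≡ bit (b <ᵇ a) + altRuns (a ∷ b ∷ w)
zeroRuns-start (suc a) b w _ rewrite ∨-identityʳ (b <ᵇ suc a) = sym (+-suc _ _)

zeroRuns-complement : ∀ m e {π} → π ∈ 𝔖 m → 2 ≤ m →
  δ (zeroRuns π) e + δ (zeroRuns (complement m π)) e ≡ δ (altRuns π) e + δ (suc (altRuns π)) e
zeroRuns-complement m e {π} π∈ 2≤m with 𝔖-∈⁻ m π∈
zeroRuns-complement m e {[]} π∈ () | _ , refl , _
zeroRuns-complement m e {_ ∷ []} π∈ (s≤s ()) | _ , refl , _
zeroRuns-complement m e {a ∷ b ∷ w} π∈ 2≤m | ((a≢b ∷ _) ∷ _) , _ , inRange@(a-in ∷ b-in ∷ _) = begin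
  δ (zeroRuns (a ∷ b ∷ w)) e + δ (zeroRuns (compl m a ∷ compl m b ∷ complement m w)) e
    ≡⟨ cong₂ (λ x y → δ x e + δ y e) (zeroRuns-start a b w (proj₁ a-in)) (zeroRuns-start (compl m a) (compl m b) (complement m w) (proj₁ (compl-inRange a-in))) ⟩
  δ (bit (b <ᵇ a) + r) e + δ (bit (compl m b <ᵇ compl m a) + altRuns (complement m (a ∷ b ∷ w))) e
    ≡⟨ cong₂ (λ x y → δ (bit (b <ᵇ a) + r) e + δ (bit x + y) e) (sym (compl-<ᵇ a-in b-in)) (altRuns-complement m (a ∷ b ∷ w) inRange) ⟩
  δ (bit (b <ᵇ a) + r) e + δ (bit (a <ᵇ b) + r) e
    ≡⟨ oneEach ⟩
  δ r e + δ (suc r) e ∎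
  where
  open ≡-Reasoning
  r : ℕ
  r = altRuns (a ∷ b ∷ w)
  oneEach : δ (bit (b <ᵇ a) + r) e + δ (bit (a <ᵇ b) + r) e ≡ δ r e + δ (suc r) e
  oneEach with <-cmp a b
  ... | tri< a<b _ _ rewrite <ᵇ-true a<b | <ᵇ-false (<⇒≯ a<b) = refl
  ... | tri≈ _ a≡b _ = ⊥-elim (a≢b a≡b)
  ... | tri> _ _ b<a rewrite <ᵇ-true b<a | <ᵇ-false (<⇒≯ b<a) = +-comm (δ (suc r) e) (δ r e)

-- hence, summing over 𝔖 m and using that complementation permutes 𝔖 m,
-- 2 M_m(x) = (1 + x) R_m(x)
Rpoly-identity : ∀ m → 2 ≤ m → onePlusX ⊛ Rpoly m ≈P 2 ·P Mpoly m
Rpoly-identity m 2≤m e = begin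
  (onePlusX ⊛ Rpoly m) e
    ≡⟨ onePlusX⊛-genPoly {L = 𝔖 m} {altRuns} (Rpoly-genPoly m 2≤m) e ⟩
  sumOf (𝔖 m) (λ π → δ (altRuns π) e) + sumOf (𝔖 m) (λ π → δ (suc (altRuns π)) e)
    ≡⟨ sym (sumOf-+ (𝔖 m) _ _) ⟩
  sumOf (𝔖 m) (λ π → δ (altRuns π) e + δ (suc (altRuns π)) e)
    ≡⟨ sym (sumOf-cong (𝔖 m) (λ π∈ → zeroRuns-complement m e π∈ 2≤m)) ⟩
  sumOf (𝔖 m) (λ π → δ (zeroRuns π) e + δ (zeroRuns (complement m π)) e)
    ≡⟨ sumOf-+ (𝔖 m) _ _ ⟩
  Mₑ + sumOf (𝔖 m) (λ π → δ (zeroRuns (complement m π)) e)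
    ≡⟨ cong₂ _+_ (sym (Mpoly-genPoly m e)) (trans (sumOf-complement m (λ π → δ (zeroRuns π) e)) (sym (Mpoly-genPoly m e))) ⟩
  Mpoly m e + Mpoly m e
    ≡⟨ cong (Mpoly m e +_) (sym (+-identityʳ (Mpoly m e))) ⟩
  2 * Mpoly m e ∎
  where
  open ≡-Reasoning
  Mₑ : ℕ
  Mₑ = sumOf (𝔖 m) (λ π → δ (zeroRuns π) e)

mainTheorem6 : (n : ℕ) → 1 ≤ n →
    (onePlusX ⊛ Rpoly (suc n) ≈P 2 ·P X* (convSum n))
    × (Mpoly (suc n) ≈P X* (convSum n))
mainTheorem6 n 1≤n =
  (λ e → trans (Rpoly-identity (suc n) (s≤s 1≤n) e) (cong (2 *_) (Mpoly-identity n e))) ,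
  Mpoly-identity n
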